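{- Let $r,n$ be positive integers, let $\pi_0\in G_{r,n}$, let $M=M(\pi_0)=(t_i^j)$ and let $w=w_{\pi_0}$ be the associated excedance word. Write $\Psi(w)=(w'_1\cdots w'_{n-1})\in\{a,b,a+b\}^{n-1}$ in the form $\Psi(w)=a^{n_1}x_1a^{n_2}x_2\cdots x_ka^{n_{k+1}}$ with $n_1,\dots,n_{k+1}\ge 0$ and $x_1,\dots,x_k\in\{b,a+b\}$ (so $k$ is the number of letters of $\Psi(w)$ different from $a$). Let $I(w)=\{i\in\{1,\dots,k\}: x_i=a+b\}$ and $$R_k=\{\mathbf r=(r_1,\dots,r_{k+1})\in\mathbb{Z}^{k+1} : r_1=1,\ r_{i+1}-r_i\in\{0,1\}\text{ for all } i,\ r_{i+1}-r_i=1 \text{ if } i\in I(w)\}.$$ For $\mathbf r\in R_k$ let $h(\mathbf r)=|\{i\in\{1,\dots,k\}: r_i=r_{i+1}\}|$. Then $$[w]=[\Psi(w)]=\sum_{\mathbf r\in R_k}(-1)^{h(\mathbf r)}\prod_{i=1}^{k+1} r_i^{\,n_i+1}.$$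
   Context: Let $\Sigma=\{i^{[j]} : 1\le i\le n,\ 0\le j\le r-1\}$ be the set $[n]$ colored by the colors $0,\dots,r-1$. The group $G_{r,n}=\mathbb{Z}_r\wr S_n$ of colored permutations is identified with the set of bijections $\pi:\Sigma\to\Sigma$ such that whenever $\pi(i^{[\alpha]})=j^{[\beta]}$, also $\pi(i^{[\alpha+1]})=j^{[\beta+1]}$ (color indices mod $r$). The color order on $\Sigma$ is $1^{[r-1]}<\cdots<n^{[r-1]}<1^{[r-2]}<\cdots<n^{[r-2]}<\cdots<1^{[0]}<\cdots<n^{[0]}$. To $\pi\in G_{r,n}$ associate the $r\times n$ matrix $M(\pi)=(t_i^j)$, rows indexed by $j=r-1,\dots,0$ (top to bottom), columns by $i=1,\dots,n$, with $t_i^j=b$ if $\pi(i^{[j]})>i^{[j]}$ in the color order and $t_i^j=a$ otherwise. The excedance word $w_\pi\in\{a,b\}^{rn-1}$ is obtained by reading $M(\pi)$ row by row from row $j=r-1$ down to row $j=0$, each row left to right, omitting the last entry $t_n^0$. For $w\in\{a,b\}^{rn-1}$, $[w]$ is the number of $\pi\in G_{r,n}$ with $w_\pi=w$. The map $\Psi$ sends the matrix $M=(t_i^j)$ (equivalently its word $w$) to $\Psi(w)=(w'_1\cdots w'_{n-1})$, where for $1\le i\le n-1$: $w'_i=a$ if $t_i^j=a$ for all $j$; $w'_i=b$ if $t_i^j=b$ for all $j$; and $w'_i=a+b$ otherwise. For the symmetric group $S_n$ and $\sigma\in S_n$, the excedance word of $\sigma$ is $u_\sigma=(u_1\cdots u_{n-1})$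 with $u_i=b$ if $\sigma(i)>i$ and $u_i=a$ otherwise. For a word $v=(v_1\cdots v_{n-1})\in\{a,b,a+b\}^{n-1}$, $[v]$ denotes the number of $\sigma\in S_n$ such that $u_i=v_i$ for every $i$ with $v_i\in\{a,b\}$ (a letter $a+b$ means the position is unconstrained). -}

module Defs where

open import Data.Bool using (Bool; true; false; _∧_; _∨_; not; if_then_else_)
open import Data.Nat using (ℕ; zero; suc; _+_; _*_; _∸_; _^_; _%_; _≡ᵇ_; _<ᵇ_; NonZero)
open import Data.Fin using (Fin; toℕ)
open import Data.Vec using (Vec; []; _∷_; lookup)
open import Data.List using (List; []; _∷_; [_]; map; concatMap; length; filterᵇ; take; reverse; allFin; zipWith; foldr; upTo; _++_)
open import Data.Product using (_×_; _,_; proj₁; proj₂)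
open import Data.Integer using (ℤ; +_; -[1+_])
import Data.Integer as ℤ

data Letter : Set where
  a b : Letter

-- letters of Ψ(w) and of the words for S_n : a, b, a+b
data Letter3 : Set where
  A B AB : Letter3

_==L_ : Letter → Letter → Bool
a ==L a = true
b ==L b = true
_ ==L _ = false

_==W_ : List Letter → List Letter → Bool
[] ==W [] = true
(x ∷ xs) ==W (y ∷ ys) = (x ==L y) ∧ (xs ==W ys)
_ ==W _ = false

all? : {X : Set} → (X → Bool) → List X → Bool
all? p = foldr (λ x acc → p x ∧ acc) true

allVecs : (k m : ℕ) → List (Vec (Fin k) m)
allVecs k zero = [ [] ]
allVecs k (suc m) = concatMap (λ x → map (x ∷_) (allVecs k m)) (allFin k)

distinct : {k : ℕ} → List (Fin k) → Bool
distinct [] = true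
distinct (x ∷ xs) = all? (λ y → not (toℕ x ≡ᵇ toℕ y)) xs ∧ distinct xs

toList : {X : Set} {m : ℕ} → Vec X m → List X
toList [] = []
toList (x ∷ xs) = x ∷ toList xs

-- σ ∈ S_n represented by its list of values (σ(1),…,σ(n)) (0-based)
isPerm : {n : ℕ} → Vec (Fin n) n → Bool
isPerm σ = distinct (toList σ)

-- Colored permutations G_{r,n} = Z_r ≀ S_n.
-- π = (σ , c) with σ ∈ S_n and c ∈ (Z_r)^n; as a bijection of
-- Σ = {i^[j]} it acts by  π(i^[α]) = σ(i)^[α + c_i mod r].
-- Elements of Σ are pairs (i , j) : Fin n × ℕ (letter i+1, color j < r).

ColPerm : ℕ → ℕ → Set
ColPerm r n = Vec (Fin n) n × Vec (Fin r) n

allColPerms : (r n : ℕ) → List (ColPerm r n)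
allColPerms r n = concatMap (λ σ → map (σ ,_) (allVecs r n)) (filterᵇ isPerm (allVecs n n))

isColPerm : {r n : ℕ} → ColPerm r n → Bool
isColPerm (σ , c) = isPerm σ

act : (r : ℕ) .{{_ : NonZero r}} {n : ℕ} → ColPerm r n → Fin n × ℕ → Fin n × ℕ
act r (σ , c) (i , α) = lookup σ i , (α + toℕ (lookup c i)) % r

-- strict color order: 1^[r-1] < … < n^[r-1] < … < 1^[0] < … < n^[0]
colorLess : {n : ℕ} → Fin n × ℕ → Fin n × ℕ → Bool
colorLess (i , j) (i' , j') = (j' <ᵇ j) ∨ ((j ≡ᵇ j') ∧ (toℕ i <ᵇ toℕ i'))

entry : (r : ℕ) .{{_ : NonZero r}} {n : ℕ} → ColPerm r n → Fin n → ℕ → Letter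
entry r π i j = if colorLess (i , j) (act r π (i , j)) then b else a

row : (r : ℕ) .{{_ : NonZero r}} {n : ℕ} → ColPerm r n → ℕ → List Letter
row r {n} π j = map (λ i → entry r π i j) (allFin n)

-- excedance word w_π : rows j = r-1, …, 0, omitting the last entry t_n^0
excWord : (r : ℕ) .{{_ : NonZero r}} {n : ℕ} → ColPerm r n → List Letter
excWord r {n} π = take (r * n ∸ 1) (concatMap (row r π) (reverse (upTo r)))

countG : (r : ℕ) .{{_ : NonZero r}} (n : ℕ) → List Letter → ℕ
countG r n w = length (filterᵇ (λ π → excWord r π ==W w) (allColPerms r n))

column : (r : ℕ) .{{_ : NonZero r}} {n : ℕ} → ColPerm r n → Fin n → List Letter
column r π i = map (entry r π i) (upTo r)

collapse : List Letter → Letter3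
collapse col =
  if all? (_==L a) col then A else (if all? (_==L b) col then B else AB)

Ψ : (r : ℕ) .{{_ : NonZero r}} {n : ℕ} → ColPerm r n → List Letter3
Ψ r {n} π = map (λ i → collapse (column r π i)) (take (n ∸ 1) (allFin n))

excWordS : {n : ℕ} → Vec (Fin n) n → List Letter
excWordS {n} σ =
  take (n ∸ 1) (map (λ i → if toℕ i <ᵇ toℕ (lookup σ i) then b else a) (allFin n))

compat : List Letter3 → List Letter → Bool
compat [] [] = true
compat (A ∷ vs) (a ∷ us) = compat vs us
compat (B ∷ vs) (b ∷ us) = compat vs us
compat (AB ∷ vs) (_ ∷ us) = compat vs us
compat _ _ = false

countS : (n : ℕ) → List Letter3 → ℕ
countS n v = length (filterᵇ (λ σ → compat v (excWordS σ)) (filterᵇ isPerm (allVecs n n)))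

-- decomposition v = a^{n_1} x_1 a^{n_2} x_2 … x_k a^{n_{k+1}}
-- blocks v = ((n_1 , … , n_{k+1}) , (x_1 , … , x_k))

blocks : List Letter3 → List ℕ × List Letter3
blocks [] = [ 0 ] , []
blocks (A ∷ v) with blocks v
... | [] , xs = [ 1 ] , xs
... | (m ∷ ms) , xs = (suc m ∷ ms) , xs
blocks (x ∷ v) with blocks v
... | ms , xs = (0 ∷ ms) , (x ∷ xs)

natLists : ℕ → ℕ → List (List ℕ)
natLists bound zero = [ [] ]
natLists bound (suc len) =
  concatMap (λ x → map (x ∷_) (natLists bound len)) (upTo (suc bound))

isAB : Letter3 → Bool
isAB AB = true
isAB _ = false

stepsOK : List ℕ → List Letter3 → Bool
stepsOK (r₁ ∷ []) [] = true
stepsOK (r₁ ∷ r₂ ∷ rs) (x ∷ xs) =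
  (((r₂ ≡ᵇ suc r₁) ∨ ((r₂ ≡ᵇ r₁) ∧ not (isAB x))) ∧ stepsOK (r₂ ∷ rs) xs)
stepsOK _ _ = false

inR : List Letter3 → List ℕ → Bool
inR xs [] = false
inR xs (r₁ ∷ rs) = (r₁ ≡ᵇ 1) ∧ stepsOK (r₁ ∷ rs) xs

-- R_k, enumerated: every element has entries 1 ≤ r_i ≤ k+1
Rk : List Letter3 → List (List ℕ)
Rk xs = filterᵇ (inR xs) (natLists (suc (length xs)) (suc (length xs)))

h : List ℕ → ℕ
h (r₁ ∷ r₂ ∷ rs) = (if r₁ ≡ᵇ r₂ then 1 else 0) + h (r₂ ∷ rs)
h _ = 0

sumℤ : List ℤ → ℤ
sumℤ = foldr ℤ._+_ (+ 0)

prodℤ : List ℤ → ℤ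
prodℤ = foldr ℤ._*_ (+ 1)

formula : List Letter3 → ℤ
formula v with blocks v
... | ns , xs =
  sumℤ (map (λ rr → (-[1+ 0 ] ℤ.^ h rr) ℤ.* prodℤ (zipWith (λ ri ni → + (ri ^ (ni + 1))) rr ns))
            (Rk xs))

module Submission where

-- For π = (σ , c) and j < r, t_i^j = shape c_i u_i j, where u_i is the
-- excedance letter of σ at i (entry-shape): a column of color 0 is constant, a column of
-- color c_i > 0 reads a…ab…b and determines c_i (column-determines).  Since w_π records
-- all of M(π) (excWord-entries), w_π = w_{π₀} iff c = c₀ and σ is compatible with
-- Ψ(w_{π₀}); so every σ carries one or no element of the fibre (Fibres.fibre).
--
-- Both [v] and the signed sum equal F 1 v, where F s [] = s, F s (a v) = s·F s v,
-- F s ((a+b) v) = s·F (s+1) v and F s (b v) = s·F (s+1) v − s·F s v.  The signed sum is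
-- evaluated one step r_i → r_{i+1} at a time (formula-F).  For v without b, [v] counts
-- injections under upper bounds σ(i) ≤ β_i; that count is invariant under reordering the
-- bounds and a product for sorted bounds (countS-noB).  A letter b is then removed by
-- inclusion–exclusion [p b q] = [p (a+b) q] − [p a q], which F obeys too (countS-F).

open import Defs
open import Data.Bool using (Bool; true; false; _∧_; _∨_; not; if_then_else_; T)
open import Data.Bool.Properties using (T-≡; ∧-commutativeMonoid; ∧-comm; ∧-identityʳ; ∧-zeroʳ; ∨-identityʳ; ∧-distribˡ-∨)
open import Algebra.Solver.CommutativeMonoid ∧-commutativeMonoid using (solve; _⊕_; _⊜_)
open import Data.Nat using (ℕ; zero; suc; _+_; _*_; _∸_; _^_; _%_; _⊓_; _≡ᵇ_; _<ᵇ_; _≤_; _<_; s≤s; z<s; NonZero; _!)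
open import Data.Nat.Properties
open import Data.Nat.ListAction using (sum)
open import Algebra.Properties.CommutativeSemigroup +-commutativeSemigroup using (interchange)
open import Data.Nat.DivMod using (m<n⇒m%n≡m; [m+n]%n≡m%n)
open import Data.Integer using (ℤ; +_; -[1+_])
import Data.Integer as ℤ
import Data.Integer.Properties as ℤP
open import Data.Integer.Tactic.RingSolver using (solve-∀)
open import Data.Fin using (Fin; toℕ; fromℕ; inject₁) renaming (zero to fzero; suc to fsuc)
open import Data.Fin.Properties using (toℕ<n; toℕ-injective; toℕ-fromℕ)
open import Data.Vec using (Vec; []; _∷_; lookup)
open import Data.List using (List; []; _∷_; [_]; map; concatMap; concat; length; filterᵇ; _++_; _∷ʳ_; zipWith;
  upTo; applyUpTo; allFin; tabulate; replicate; take; reverse)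
open import Data.List.Properties using (upTo-∷ʳ; map-tabulate; tabulate-cong; ++-identityʳ; ++-assoc; length-++; length-map;
  length-reverse; length-applyUpTo; length-tabulate; unfold-reverse; concatMap-++; map-++; ∷-injective; map-cong-local; take-map; map-∘)
open import Data.List.Membership.Propositional using (_∈_)
open import Data.List.Membership.Propositional.Properties using (∈-upTo⁺; ∈-upTo⁻; ∈-map⁺; ∈-allFin)
import Data.List.Relation.Unary.Any.Properties as Any
open import Data.List.Relation.Unary.Any using (here; there)
open import Data.List.Relation.Unary.All using (All; []; _∷_)
import Data.List.Relation.Unary.All as All
open import Data.List.Relation.Binary.Permutation.Propositional using (_↭_; prep; swap; ↭-sym)
  renaming (refl to ↭-refl; trans to ↭-trans)
open import Data.List.Relation.Binary.Permutation.Propositional.Properties using (shift)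
open import Data.Product using (_×_; _,_; proj₁; proj₂; Σ)
open import Data.Sum using (_⊎_; inj₁; inj₂)
open import Data.Unit using (⊤; tt)
open import Data.Empty using (⊥; ⊥-elim)
open import Function.Bundles using (Equivalence)
open import Relation.Nullary using (¬_; yes; no)
open import Relation.Binary using (tri<; tri≈; tri>)
open import Relation.Binary.PropositionalEquality hiding ([_])

open Equivalence using (to; from)

≡ᵇ-refl : ∀ n → (n ≡ᵇ n) ≡ true
≡ᵇ-refl n = to T-≡ (≡⇒≡ᵇ n n refl)

≡ᵇ-sound : ∀ m n → (m ≡ᵇ n) ≡ true → m ≡ n
≡ᵇ-sound m n e = ≡ᵇ⇒≡ m n (from T-≡ e)

≡ᵇ-false : ∀ {m n} → m ≢ n → (m ≡ᵇ n) ≡ false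
≡ᵇ-false {zero} {zero} ne = ⊥-elim (ne refl)
≡ᵇ-false {zero} {suc n} ne = refl
≡ᵇ-false {suc m} {zero} ne = refl
≡ᵇ-false {suc m} {suc n} ne = ≡ᵇ-false (λ e → ne (cong suc e))

≡ᵇ-sym : ∀ m n → (m ≡ᵇ n) ≡ (n ≡ᵇ m)
≡ᵇ-sym zero zero = refl
≡ᵇ-sym zero (suc n) = refl
≡ᵇ-sym (suc m) zero = refl
≡ᵇ-sym (suc m) (suc n) = ≡ᵇ-sym m n

<ᵇ-true : ∀ {m n} → m < n → (m <ᵇ n) ≡ true
<ᵇ-true lt = to T-≡ (<⇒<ᵇ lt)

<ᵇ-false : ∀ {m n} → n ≤ m → (m <ᵇ n) ≡ false
<ᵇ-false {m} {zero} _ = refl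
<ᵇ-false {suc m} {suc n} (s≤s le) = <ᵇ-false {m} {n} le

ind : Bool → ℕ
ind c = if c then 1 else 0

cnt : {X : Set} → (X → Bool) → List X → ℕ
cnt p l = length (filterᵇ p l)

cnt-cons : {X : Set} (p : X → Bool) (x : X) (xs : List X) → cnt p (x ∷ xs) ≡ ind (p x) + cnt p xs
cnt-cons p x xs with p x
... | true = refl
... | false = refl

cnt-++ : {X : Set} (p : X → Bool) (xs ys : List X) → cnt p (xs ++ ys) ≡ cnt p xs + cnt p ys
cnt-++ p [] ys = refl
cnt-++ p (x ∷ xs) ys rewrite cnt-cons p x (xs ++ ys) | cnt-cons p x xs | cnt-++ p xs ys =
  sym (+-assoc (ind (p x)) _ _)

cnt-concatMap : {X Y : Set} (p : Y → Bool) (f : X → List Y) (l : List X) →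
  cnt p (concatMap f l) ≡ sum (map (λ x → cnt p (f x)) l)
cnt-concatMap p f [] = refl
cnt-concatMap p f (x ∷ l) = trans (cnt-++ p (f x) (concatMap f l)) (cong (_+_ (cnt p (f x))) (cnt-concatMap p f l))

cnt-map : {X Y : Set} (p : Y → Bool) (g : X → Y) (l : List X) → cnt p (map g l) ≡ cnt (λ x → p (g x)) l
cnt-map p g [] = refl
cnt-map p g (x ∷ l) rewrite cnt-cons p (g x) (map g l) | cnt-cons (λ x → p (g x)) x l | cnt-map p g l = refl

cnt-cong : {X : Set} {p q : X → Bool} → (∀ x → p x ≡ q x) → (l : List X) → cnt p l ≡ cnt q l
cnt-cong e [] = refl
cnt-cong {p = p} {q} e (x ∷ l) rewrite cnt-cons p x l | cnt-cons q x l | e x | cnt-cong e l = refl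

cnt-false : {X : Set} (l : List X) → cnt (λ _ → false) l ≡ 0
cnt-false [] = refl
cnt-false (x ∷ l) = cnt-false l

cnt-guard : {X : Set} (k : Bool) (q : X → Bool) (l : List X) → cnt (λ x → k ∧ q x) l ≡ (if k then cnt q l else 0)
cnt-guard true q l = refl
cnt-guard false q l = cnt-false l

cnt-or : {X : Set} (p q : X → Bool) → (∀ x → p x ∧ q x ≡ false) → (l : List X) →
  cnt (λ x → p x ∨ q x) l ≡ cnt p l + cnt q l
cnt-or p q excl [] = refl
cnt-or p q excl (x ∷ l) rewrite cnt-cons (λ x → p x ∨ q x) x l | cnt-cons p x l | cnt-cons q x l
  | cnt-or p q excl l with p x | q x | excl x
... | true | false | _ = refl
... | false | true | _ = sym (+-suc (cnt p l) (cnt q l))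
... | false | false | _ = refl

cnt-filter : {X : Set} (p q : X → Bool) (l : List X) → cnt p (filterᵇ q l) ≡ cnt (λ x → q x ∧ p x) l
cnt-filter p q [] = refl
cnt-filter p q (x ∷ l) rewrite cnt-cons (λ x → q x ∧ p x) x l with q x
... | true = trans (cnt-cons p x (filterᵇ q l)) (cong (_+_ (ind (p x))) (cnt-filter p q l))
... | false = cnt-filter p q l

sum-cong : {X : Set} {f g : X → ℕ} → (∀ x → f x ≡ g x) → (l : List X) → sum (map f l) ≡ sum (map g l)
sum-cong e [] = refl
sum-cong e (x ∷ l) = cong₂ _+_ (e x) (sum-cong e l)

sum-zero : {X : Set} (l : List X) → sum (map (λ _ → 0) l) ≡ 0
sum-zero [] = refl
sum-zero (x ∷ l) = sum-zero l

sum-+ : {X : Set} (f g : X → ℕ) (l : List X) → sum (map (λ x → f x + g x) l) ≡ sum (map f l) + sum (map g l)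
sum-+ f g [] = refl
sum-+ f g (x ∷ l) rewrite sum-+ f g l = interchange (f x) (g x) (sum (map f l)) (sum (map g l))

sum-swap : {X Y : Set} (f : X → Y → ℕ) (l₁ : List X) (l₂ : List Y) →
  sum (map (λ x → sum (map (λ y → f x y) l₂)) l₁) ≡ sum (map (λ y → sum (map (λ x → f x y) l₁)) l₂)
sum-swap f [] l₂ = sym (sum-zero l₂)
sum-swap f (x ∷ l₁) l₂ rewrite sum-swap f l₁ l₂ = sym (sum-+ (λ y → f x y) (λ y → sum (map (λ x → f x y) l₁)) l₂)

sum-guard : {X : Set} (k : Bool) (f : X → ℕ) (l : List X) → (if k then sum (map f l) else 0) ≡ sum (map (λ y → if k then f y else 0) l)
sum-guard true f l = refl
sum-guard false f l = sym (sum-zero l)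

guard-guard : ∀ (p q : Bool) (v : ℕ) → (if p then (if q then v else 0) else 0) ≡ (if p ∧ q then v else 0)
guard-guard true q v = refl
guard-guard false q v = refl

sum-ind : {X : Set} (p : X → Bool) (l : List X) → sum (map (λ x → ind (p x)) l) ≡ cnt p l
sum-ind p [] = refl
sum-ind p (x ∷ l) = trans (cong (_+_ (ind (p x))) (sum-ind p l)) (sym (cnt-cons p x l))

sum-guarded-const : {X : Set} (p : X → Bool) (c : ℕ) (l : List X) → sum (map (λ x → if p x then c else 0) l) ≡ cnt p l * c
sum-guarded-const p c [] = refl
sum-guarded-const p c (x ∷ l) rewrite cnt-cons p x l | sum-guarded-const p c l with p x
... | true = refl
... | false = refl

SZ : {X : Set} → (X → Bool) → (X → ℤ) → List X → ℤ
SZ P w l = sumℤ (map w (filterᵇ P l))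

SZ-cons : {X : Set} (P : X → Bool) (w : X → ℤ) (x : X) (l : List X) →
  SZ P w (x ∷ l) ≡ (if P x then w x else + 0) ℤ.+ SZ P w l
SZ-cons P w x l with P x
... | true = refl
... | false = sym (ℤP.+-identityˡ _)

SZ-as-sum : {X : Set} (P : X → Bool) (w : X → ℤ) (l : List X) → SZ P w l ≡ sumℤ (map (λ y → if P y then w y else + 0) l)
SZ-as-sum P w [] = refl
SZ-as-sum P w (x ∷ l) = trans (SZ-cons P w x l) (cong (λ z → (if P x then w x else + 0) ℤ.+ z) (SZ-as-sum P w l))

SZ-++ : {X : Set} (P : X → Bool) (w : X → ℤ) (xs ys : List X) → SZ P w (xs ++ ys) ≡ SZ P w xs ℤ.+ SZ P w ys
SZ-++ P w [] ys = sym (ℤP.+-identityˡ _)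
SZ-++ P w (x ∷ xs) ys rewrite SZ-cons P w x (xs ++ ys) | SZ-cons P w x xs | SZ-++ P w xs ys =
  sym (ℤP.+-assoc (if P x then w x else + 0) _ _)

SZ-concatMap : {X Y : Set} (P : Y → Bool) (w : Y → ℤ) (f : X → List Y) (l : List X) →
  SZ P w (concatMap f l) ≡ sumℤ (map (λ x → SZ P w (f x)) l)
SZ-concatMap P w f [] = refl
SZ-concatMap P w f (x ∷ l) = trans (SZ-++ P w (f x) (concatMap f l)) (cong (λ z → SZ P w (f x) ℤ.+ z) (SZ-concatMap P w f l))

SZ-map : {X Y : Set} (P : Y → Bool) (w : Y → ℤ) (g : X → Y) (l : List X) →
  SZ P w (map g l) ≡ SZ (λ x → P (g x)) (λ x → w (g x)) l
SZ-map P w g [] = refl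
SZ-map P w g (x ∷ l) rewrite SZ-cons P w (g x) (map g l) | SZ-cons (λ x → P (g x)) (λ x → w (g x)) x l
  | SZ-map P w g l = refl

SZ-cong : {X : Set} {P Q : X → Bool} {w w' : X → ℤ} → (∀ x → P x ≡ Q x) → (∀ x → Q x ≡ true → w x ≡ w' x) →
  (l : List X) → SZ P w l ≡ SZ Q w' l
SZ-cong eP ew [] = refl
SZ-cong {P = P} {Q} {w} {w'} eP ew (x ∷ l) rewrite SZ-cons P w x l | SZ-cons Q w' x l | eP x | SZ-cong eP ew l
  with Q x | ew x
... | true | e = cong (ℤ._+ SZ Q w' l) (e refl)
... | false | _ = refl

SZ-guard : {X : Set} (k : Bool) (Q : X → Bool) (w : X → ℤ) (l : List X) → SZ (λ x → k ∧ Q x) w l ≡ (if k then SZ Q w l else + 0)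
SZ-guard true Q w l = refl
SZ-guard false Q w [] = refl
SZ-guard false Q w (x ∷ l) = SZ-guard false Q w l

SZ-scale : {X : Set} (P : X → Bool) (c : ℤ) (w : X → ℤ) (l : List X) → SZ P (λ x → c ℤ.* w x) l ≡ c ℤ.* SZ P w l
SZ-scale P c w [] = sym (ℤP.*-zeroʳ c)
SZ-scale P c w (x ∷ l) rewrite SZ-cons P (λ x → c ℤ.* w x) x l | SZ-cons P w x l | SZ-scale P c w l
  | ℤP.*-distribˡ-+ c (if P x then w x else + 0) (SZ P w l) with P x
... | true = refl
... | false = cong (ℤ._+ (c ℤ.* SZ P w l)) (sym (ℤP.*-zeroʳ c))

SZ-or : {X : Set} (P Q : X → Bool) (w : X → ℤ) → (∀ x → P x ∧ Q x ≡ false) → (l : List X) →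
  SZ (λ x → P x ∨ Q x) w l ≡ SZ P w l ℤ.+ SZ Q w l
SZ-or P Q w excl [] = refl
SZ-or P Q w excl (x ∷ l) rewrite SZ-cons (λ x → P x ∨ Q x) w x l | SZ-cons P w x l | SZ-cons Q w x l | SZ-or P Q w excl l
  with P x | Q x | excl x
... | true | false | _ = shuffle (w x) (SZ P w l) (SZ Q w l)
  where shuffle : ∀ u p q → u ℤ.+ (p ℤ.+ q) ≡ (u ℤ.+ p) ℤ.+ (+ 0 ℤ.+ q)
        shuffle = solve-∀
... | false | true | _ = shuffle (w x) (SZ P w l) (SZ Q w l)
  where shuffle : ∀ u p q → u ℤ.+ (p ℤ.+ q) ≡ (+ 0 ℤ.+ p) ℤ.+ (u ℤ.+ q)
        shuffle = solve-∀
... | false | false | _ = shuffle (SZ P w l) (SZ Q w l)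
  where shuffle : ∀ p q → + 0 ℤ.+ (p ℤ.+ q) ≡ (+ 0 ℤ.+ p) ℤ.+ (+ 0 ℤ.+ q)
        shuffle = solve-∀

sumℤ-cong : {X : Set} {f g : X → ℤ} → (∀ x → f x ≡ g x) → (l : List X) → sumℤ (map f l) ≡ sumℤ (map g l)
sumℤ-cong e [] = refl
sumℤ-cong e (x ∷ l) = cong₂ ℤ._+_ (e x) (sumℤ-cong e l)

SZ-upTo-point : (c : ℕ) (w : ℕ → ℤ) (M : ℕ) → SZ (λ y → y ≡ᵇ c) w (upTo M) ≡ (if c <ᵇ M then w c else + 0)
SZ-upTo-point c w zero = refl
SZ-upTo-point c w (suc M) = begin
  SZ (λ y → y ≡ᵇ c) w (upTo (suc M))
    ≡⟨ cong (SZ (λ y → y ≡ᵇ c) w) (sym (upTo-∷ʳ M)) ⟩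
  SZ (λ y → y ≡ᵇ c) w (upTo M ++ [ M ])
    ≡⟨ SZ-++ (λ y → y ≡ᵇ c) w (upTo M) [ M ] ⟩
  SZ (λ y → y ≡ᵇ c) w (upTo M) ℤ.+ SZ (λ y → y ≡ᵇ c) w [ M ]
    ≡⟨ cong₂ ℤ._+_ (SZ-upTo-point c w M) (SZ-cons (λ y → y ≡ᵇ c) w M []) ⟩
  (if c <ᵇ M then w c else + 0) ℤ.+ ((if M ≡ᵇ c then w M else + 0) ℤ.+ + 0)
    ≡⟨ last-step ⟩
  (if c <ᵇ suc M then w c else + 0) ∎
  where
  open ≡-Reasoning
  last-step : (if c <ᵇ M then w c else + 0) ℤ.+ ((if M ≡ᵇ c then w M else + 0) ℤ.+ + 0) ≡ (if c <ᵇ suc M then w c else + 0)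
  last-step with <-cmp c M
  ... | tri< c<M _ _ rewrite <ᵇ-true c<M | <ᵇ-true (m<n⇒m<1+n c<M) | ≡ᵇ-false (>⇒≢ c<M) =
    trans (cong (λ z → w c ℤ.+ z) (ℤP.+-identityʳ (+ 0))) (ℤP.+-identityʳ (w c))
  ... | tri≈ _ refl _ rewrite <ᵇ-false (≤-refl {c}) | <ᵇ-true (n<1+n c) | ≡ᵇ-refl c =
    trans (ℤP.+-identityˡ _) (ℤP.+-identityʳ (w c))
  ... | tri> _ _ M<c rewrite <ᵇ-false (<⇒≤ M<c) | <ᵇ-false M<c | ≡ᵇ-false (<⇒≢ M<c) = refl

-- The recursion F shared by both sides of part (2)

F : ℕ → List Letter3 → ℤ
F s [] = + s
F s (A ∷ v) = + s ℤ.* F s v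
F s (B ∷ v) = + s ℤ.* F (suc s) v ℤ.- + s ℤ.* F s v
F s (AB ∷ v) = + s ℤ.* F (suc s) v

*-distribˡ-− : ∀ x y z → x ℤ.* (y ℤ.- z) ≡ x ℤ.* y ℤ.- x ℤ.* z
*-distribˡ-− = solve-∀

F-split : ∀ p q s → F s (p ++ B ∷ q) ≡ F s (p ++ AB ∷ q) ℤ.- F s (p ++ A ∷ q)
F-split [] q s = refl
F-split (A ∷ p) q s rewrite F-split p q s = *-distribˡ-− (+ s) _ _
F-split (AB ∷ p) q s rewrite F-split p q (suc s) = *-distribˡ-− (+ s) _ _
F-split (B ∷ p) q s rewrite F-split p q (suc s) | F-split p q s = distrib (+ s) _ _ _ _
  where distrib : ∀ x y z u v → x ℤ.* (y ℤ.- z) ℤ.- x ℤ.* (u ℤ.- v) ≡ (x ℤ.* y ℤ.- x ℤ.* u) ℤ.- (x ℤ.* z ℤ.- x ℤ.* v)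
        distrib = solve-∀

-- The signed sum over R_k equals F 1 v

-- The factor r^{m+1} contributed at level r by the block a^m (1 once the blocks are used up).
blockFactor : ℕ → List ℕ → ℤ
blockFactor s [] = + 1
blockFactor s (m ∷ ms) = + (s ^ (m + 1))

dropBlock : List ℕ → List ℕ
dropBlock [] = []
dropBlock (m ∷ ms) = ms

summand : List ℕ → List ℕ → ℤ
summand ns rr = (-[1+ 0 ] ℤ.^ h rr) ℤ.* prodℤ (zipWith (λ ri ni → + (ri ^ (ni + 1))) rr ns)

stepSign : ℕ → ℕ → ℤ
stepSign s y = -[1+ 0 ] ℤ.^ ind (s ≡ᵇ y)

summand-single : ∀ s ns → summand ns [ s ] ≡ blockFactor s ns
summand-single s [] = refl
summand-single s (m ∷ ms) = trans (ℤP.*-identityˡ _) (ℤP.*-identityʳ _)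

summand-split : ∀ s y t ns → summand ns (s ∷ y ∷ t) ≡ (stepSign s y ℤ.* blockFactor s ns) ℤ.* summand (dropBlock ns) (y ∷ t)
summand-split s y t [] rewrite ℤP.^-distribˡ-+-* -[1+ 0 ] (ind (s ≡ᵇ y)) (h (y ∷ t)) =
  regroup (stepSign s y) (-[1+ 0 ] ℤ.^ h (y ∷ t))
  where regroup : ∀ u v → (u ℤ.* v) ℤ.* + 1 ≡ (u ℤ.* + 1) ℤ.* (v ℤ.* + 1)
        regroup = solve-∀
summand-split s y t (m ∷ ms) rewrite ℤP.^-distribˡ-+-* -[1+ 0 ] (ind (s ≡ᵇ y)) (h (y ∷ t)) =
  regroup (stepSign s y) (-[1+ 0 ] ℤ.^ h (y ∷ t)) _ _
  where regroup : ∀ u v p q → (u ℤ.* v) ℤ.* (p ℤ.* q) ≡ (u ℤ.* p) ℤ.* (v ℤ.* q)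
        regroup = solve-∀

step : ℕ → ℕ → Letter3 → Bool
step s y x = (y ≡ᵇ suc s) ∨ ((y ≡ᵇ s) ∧ not (isAB x))

step-bound : ∀ s y x → step s y x ≡ true → y ≤ suc s
step-bound s y x e with y ≡ᵇ suc s in e₁
... | true rewrite ≡ᵇ-sound y (suc s) e₁ = ≤-refl
... | false with y ≡ᵇ s in e₂
...   | true rewrite ≡ᵇ-sound y s e₂ = n≤1+n s

step-exclusive : ∀ s x y → (y ≡ᵇ suc s) ∧ ((y ≡ᵇ s) ∧ not (isAB x)) ≡ false
step-exclusive s x y with y ≡ᵇ suc s in e
... | false = refl
... | true rewrite ≡ᵇ-sound y (suc s) e | ≡ᵇ-false (>⇒≢ (n<1+n s)) = refl

SZ-step : ∀ Bd s x (w : ℕ → ℤ) → s < Bd →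
  SZ (λ y → step s y x) w (upTo (suc Bd)) ≡ w (suc s) ℤ.+ (if isAB x then + 0 else w s)
SZ-step Bd s x w s<Bd = begin
  SZ (λ y → step s y x) w (upTo (suc Bd))
    ≡⟨ SZ-or (λ y → y ≡ᵇ suc s) (λ y → (y ≡ᵇ s) ∧ not (isAB x)) w (step-exclusive s x) (upTo (suc Bd)) ⟩
  SZ (λ y → y ≡ᵇ suc s) w (upTo (suc Bd)) ℤ.+ SZ (λ y → (y ≡ᵇ s) ∧ not (isAB x)) w (upTo (suc Bd))
    ≡⟨ cong₂ ℤ._+_ (SZ-upTo-point (suc s) w (suc Bd)) stay ⟩
  (if suc s <ᵇ suc Bd then w (suc s) else + 0) ℤ.+ (if not (isAB x) then (if s <ᵇ suc Bd then w s else + 0) else + 0)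
    ≡⟨ cong₂ (λ p q → (if p then w (suc s) else + 0) ℤ.+ (if not (isAB x) then (if q then w s else + 0) else + 0))
         (<ᵇ-true (s≤s s<Bd)) (<ᵇ-true (m<n⇒m<1+n s<Bd)) ⟩
  w (suc s) ℤ.+ (if not (isAB x) then w s else + 0)
    ≡⟨ cong (λ z → w (suc s) ℤ.+ z) (flip (isAB x)) ⟩
  w (suc s) ℤ.+ (if isAB x then + 0 else w s) ∎
  where
  open ≡-Reasoning
  stay : SZ (λ y → (y ≡ᵇ s) ∧ not (isAB x)) w (upTo (suc Bd)) ≡ (if not (isAB x) then (if s <ᵇ suc Bd then w s else + 0) else + 0)
  stay = trans (SZ-cong (λ y → ∧-comm (y ≡ᵇ s) (not (isAB x))) (λ _ _ → refl) (upTo (suc Bd)))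
    (trans (SZ-guard (not (isAB x)) (λ y → y ≡ᵇ s) w (upTo (suc Bd)))
      (cong (λ z → if not (isAB x) then z else + 0) (SZ-upTo-point s w (suc Bd))))
  flip : ∀ c → (if not c then w s else + 0) ≡ (if c then + 0 else w s)
  flip true = refl
  flip false = refl

SZ-natLists : ∀ Bd L (P : List ℕ → Bool) (w : List ℕ → ℤ) →
  SZ P w (natLists Bd (suc L)) ≡ sumℤ (map (λ y → SZ (λ t → P (y ∷ t)) (λ t → w (y ∷ t)) (natLists Bd L)) (upTo (suc Bd)))
SZ-natLists Bd L P w = trans (SZ-concatMap P w (λ y → map (y ∷_) (natLists Bd L)) (upTo (suc Bd)))
  (sumℤ-cong (λ y → SZ-map P w (y ∷_) (natLists Bd L)) (upTo (suc Bd)))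

-- levelSum s xs ns: the signed sum over all continuations of the level r_i = s across the
-- letters xs, computed one step at a time.
levelSum : ℕ → List Letter3 → List ℕ → ℤ
levelSum s [] ns = blockFactor s ns
levelSum s (x ∷ xs) ns =
  blockFactor s ns ℤ.* (levelSum (suc s) xs (dropBlock ns) ℤ.+ (if isAB x then + 0 else ℤ.- levelSum s xs (dropBlock ns)))

-- The enumerated signed sum over continuations of the level s equals levelSum (the bound Bd
-- is large enough to contain every admissible sequence).
levelSum-correct : ∀ Bd s xs ns → s + length xs ≤ Bd →
  SZ (λ t → stepsOK (s ∷ t) xs) (λ t → summand ns (s ∷ t)) (natLists Bd (length xs)) ≡ levelSum s xs ns
levelSum-correct Bd s [] ns _ = trans (ℤP.+-identityʳ _) (summand-single s ns)
levelSum-correct Bd s (x ∷ xs) ns bound = begin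
  SZ (λ t → stepsOK (s ∷ t) (x ∷ xs)) (λ t → summand ns (s ∷ t)) (natLists Bd (suc (length xs)))
    ≡⟨ SZ-natLists Bd (length xs) _ _ ⟩
  sumℤ (map (λ y → SZ (λ t → stepsOK (s ∷ y ∷ t) (x ∷ xs)) (λ t → summand ns (s ∷ y ∷ t)) NL) (upTo (suc Bd)))
    ≡⟨ sumℤ-cong headTerm (upTo (suc Bd)) ⟩
  sumℤ (map (λ y → if step s y x then H y else + 0) (upTo (suc Bd)))
    ≡⟨ sym (SZ-as-sum (λ y → step s y x) H (upTo (suc Bd))) ⟩
  SZ (λ y → step s y x) H (upTo (suc Bd))
    ≡⟨ SZ-step Bd s x H (≤-trans (s≤s (m≤m+n s (length xs))) bound′) ⟩
  H (suc s) ℤ.+ (if isAB x then + 0 else H s)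
    ≡⟨ collect (isAB x) ⟩
  levelSum s (x ∷ xs) ns ∎
  where
  open ≡-Reasoning
  NL = natLists Bd (length xs)
  bound′ : suc s + length xs ≤ Bd
  bound′ = subst (_≤ Bd) (+-suc s (length xs)) bound
  H : ℕ → ℤ
  H y = (stepSign s y ℤ.* blockFactor s ns) ℤ.* levelSum y xs (dropBlock ns)
  guarded : ∀ y (c : Bool) → step s y x ≡ c →
    (if c then SZ (λ t → stepsOK (y ∷ t) xs) (λ t → (stepSign s y ℤ.* blockFactor s ns) ℤ.* summand (dropBlock ns) (y ∷ t)) NL else + 0)
      ≡ (if c then H y else + 0)
  guarded y false _ = refl
  guarded y true e = trans (SZ-scale (λ t → stepsOK (y ∷ t) xs) (stepSign s y ℤ.* blockFactor s ns) (λ t → summand (dropBlock ns) (y ∷ t)) NL) (cong (λ z → (stepSign s y ℤ.* blockFactor s ns) ℤ.* z)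
    (levelSum-correct Bd y xs (dropBlock ns) (≤-trans (+-monoˡ-≤ (length xs) (step-bound s y x e)) bound′)))
  headTerm : ∀ y → SZ (λ t → stepsOK (s ∷ y ∷ t) (x ∷ xs)) (λ t → summand ns (s ∷ y ∷ t)) NL ≡ (if step s y x then H y else + 0)
  headTerm y = trans (SZ-cong {Q = λ t → step s y x ∧ stepsOK (y ∷ t) xs} (λ _ → refl) (λ t _ → summand-split s y t ns) NL)
    (trans (SZ-guard (step s y x) (λ t → stepsOK (y ∷ t) xs) _ NL) (guarded y (step s y x) refl))
  collect : ∀ c → H (suc s) ℤ.+ (if c then + 0 else H s) ≡
    blockFactor s ns ℤ.* (levelSum (suc s) xs (dropBlock ns) ℤ.+ (if c then + 0 else ℤ.- levelSum s xs (dropBlock ns)))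
  collect true rewrite ≡ᵇ-false (<⇒≢ (n<1+n s)) = ring (blockFactor s ns) (levelSum (suc s) xs (dropBlock ns))
    where ring : ∀ f p → ((+ 1) ℤ.* f) ℤ.* p ℤ.+ + 0 ≡ f ℤ.* (p ℤ.+ + 0)
          ring = solve-∀
  collect false rewrite ≡ᵇ-false (<⇒≢ (n<1+n s)) | ≡ᵇ-refl s | ℤP.-1*i≡-i (blockFactor s ns) =
    ring (blockFactor s ns) (levelSum (suc s) xs (dropBlock ns)) (levelSum s xs (dropBlock ns))
    where ring : ∀ f p q → ((+ 1) ℤ.* f) ℤ.* p ℤ.+ (ℤ.- f) ℤ.* q ≡ f ℤ.* (p ℤ.+ ℤ.- q)
          ring = solve-∀

formula-levelSum : ∀ v → formula v ≡ levelSum 1 (proj₂ (blocks v)) (proj₁ (blocks v))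
formula-levelSum v with blocks v
... | ns , xs = begin
  SZ (inR xs) (summand ns) (natLists (suc k) (suc k))
    ≡⟨ SZ-natLists (suc k) k (inR xs) (summand ns) ⟩
  sumℤ (map (λ y → SZ (λ t → inR xs (y ∷ t)) (λ t → summand ns (y ∷ t)) NL) (upTo (suc (suc k))))
    ≡⟨ sumℤ-cong (λ y → SZ-guard (y ≡ᵇ 1) (λ t → stepsOK (y ∷ t) xs) (λ t → summand ns (y ∷ t)) NL) (upTo (suc (suc k))) ⟩
  sumℤ (map (λ y → if y ≡ᵇ 1 then S y else + 0) (upTo (suc (suc k))))
    ≡⟨ sym (SZ-as-sum (λ y → y ≡ᵇ 1) S (upTo (suc (suc k)))) ⟩
  SZ (λ y → y ≡ᵇ 1) S (upTo (suc (suc k)))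
    ≡⟨ SZ-upTo-point 1 S (suc (suc k)) ⟩
  S 1
    ≡⟨ levelSum-correct (suc k) 1 xs ns ≤-refl ⟩
  levelSum 1 xs ns ∎
  where
  open ≡-Reasoning
  k = length xs
  NL = natLists (suc k) k
  S : ℕ → ℤ
  S y = SZ (λ t → stepsOK (y ∷ t) xs) (λ t → summand ns (y ∷ t)) NL

blocks-nonempty : ∀ v → proj₁ (blocks v) ≢ []
blocks-nonempty [] ()
blocks-nonempty (A ∷ v) with blocks v
... | [] , xs = λ ()
... | m ∷ ms , xs = λ ()
blocks-nonempty (B ∷ v) with blocks v
... | ms , xs = λ ()
blocks-nonempty (AB ∷ v) with blocks v
... | ms , xs = λ ()

blockFactor-level : ∀ s → blockFactor s [ 0 ] ≡ + s
blockFactor-level s = cong +_ (*-identityʳ s)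

levelSum-A : ∀ s xs m ms → levelSum s xs (suc m ∷ ms) ≡ + s ℤ.* levelSum s xs (m ∷ ms)
levelSum-A s [] m ms = ℤP.pos-* s (s ^ (m + 1))
levelSum-A s (x ∷ xs) m ms = trans (cong (ℤ._* rest) (ℤP.pos-* s (s ^ (m + 1)))) (ℤP.*-assoc (+ s) (+ (s ^ (m + 1))) rest)
  where rest = levelSum (suc s) xs ms ℤ.+ (if isAB x then + 0 else ℤ.- levelSum s xs ms)

levelSum-F : ∀ v s → levelSum s (proj₂ (blocks v)) (proj₁ (blocks v)) ≡ F s v
levelSum-F [] s = blockFactor-level s
levelSum-F (A ∷ v) s with blocks v | levelSum-F v | blocks-nonempty v
... | [] , xs | _ | nonempty = ⊥-elim (nonempty refl)
... | m ∷ ms , xs | ih | _ = trans (levelSum-A s xs m ms) (cong (+ s ℤ.*_) (ih s))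
levelSum-F (B ∷ v) s with blocks v | levelSum-F v
... | ms , xs | ih = trans (cong₂ ℤ._*_ (blockFactor-level s) (cong₂ (λ p q → p ℤ.+ ℤ.- q) (ih (suc s)) (ih s)))
  (*-distribˡ-− (+ s) _ _)
levelSum-F (AB ∷ v) s with blocks v | levelSum-F v
... | ms , xs | ih = trans (cong₂ ℤ._*_ (blockFactor-level s) (cong (ℤ._+ + 0) (ih (suc s)))) (cong (+ s ℤ.*_) (ℤP.+-identityʳ _))

formula-F : ∀ v → formula v ≡ F 1 v
formula-F v = trans (formula-levelSum v) (levelSum-F v 1)

allFin-suc : ∀ N → allFin (suc N) ≡ fzero ∷ map fsuc (allFin N)
allFin-suc N = cong (fzero ∷_) (sym (map-tabulate (λ i → i) fsuc))

cnt-allFin-suc : ∀ {N} (p : Fin (suc N) → Bool) → cnt p (allFin (suc N)) ≡ ind (p fzero) + cnt (λ y → p (fsuc y)) (allFin N)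
cnt-allFin-suc {N} p = trans (cong (cnt p) (allFin-suc N))
  (trans (cnt-cons p fzero (map fsuc (allFin N))) (cong (_+_ (ind (p fzero))) (cnt-map p fsuc (allFin N))))

cnt-equal : ∀ {N} (x : Fin N) → cnt (λ y → toℕ x ≡ᵇ toℕ y) (allFin N) ≡ 1
cnt-equal {suc N} fzero = trans (cnt-allFin-suc {N} (λ y → 0 ≡ᵇ toℕ y)) (cong suc (cnt-false (allFin N)))
cnt-equal {suc N} (fsuc x) = trans (cnt-allFin-suc {N} (λ y → suc (toℕ x) ≡ᵇ toℕ y)) (cnt-equal x)

below : ∀ {N} → ℕ → Fin N → Bool
below β x = not (β <ᵇ toℕ x)

cnt-below : ∀ N β → cnt (below β) (allFin N) ≡ N ⊓ suc β
cnt-below zero β = refl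
cnt-below (suc N) zero = trans (cnt-allFin-suc {N} (below 0)) (cong suc (trans (cnt-false (allFin N)) (sym (⊓-zeroʳ N))))
cnt-below (suc N) (suc β) = trans (cnt-allFin-suc {N} (below (suc β))) (cong suc (cnt-below N β))

below-mono : ∀ {N β γ} (x : Fin N) → below β x ≡ true → β ≤ γ → below γ x ≡ true
below-mono {β = β} {γ} x e β≤γ with β <ᵇ toℕ x in eβ | γ <ᵇ toℕ x in eγ
... | false | false = refl
... | false | true = ⊥-elim (subst T eβ (<⇒<ᵇ (≤-<-trans β≤γ (<ᵇ⇒< γ (toℕ x) (subst T (sym eγ) tt)))))

below-top : ∀ N (x : Fin N) → below N x ≡ true
below-top N x rewrite <ᵇ-false (<⇒≤ (toℕ<n x)) = refl

all?-intro : {X : Set} (p : X → Bool) (l : List X) → (∀ {x} → x ∈ l → p x ≡ true) → all? p l ≡ true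
all?-intro p [] _ = refl
all?-intro p (x ∷ l) holds rewrite holds (here refl) = all?-intro p l (λ x∈ → holds (there x∈))

all?-elim : {X : Set} (p : X → Bool) (l : List X) → all? p l ≡ true → ∀ {x} → x ∈ l → p x ≡ true
all?-elim p (y ∷ l) e (here refl) with p y
... | true = refl
all?-elim p (y ∷ l) e (there x∈) with p y
... | true = all?-elim p l e x∈

all?-witness : {X : Set} (p : X → Bool) (l : List X) {x : X} → x ∈ l → p x ≡ false → all? p l ≡ false
all?-witness p (y ∷ l) (here refl) fails rewrite fails = refl
all?-witness p (y ∷ l) (there x∈) fails rewrite all?-witness p l x∈ fails = ∧-zeroʳ (p y)

all?-∧ : {X : Set} (p q : X → Bool) (l : List X) → all? (λ y → p y ∧ q y) l ≡ all? p l ∧ all? q l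
all?-∧ p q [] = refl
all?-∧ p q (x ∷ l) rewrite all?-∧ p q l =
  solve 4 (λ p q P Q → (p ⊕ q) ⊕ (P ⊕ Q) ⊜ (p ⊕ P) ⊕ (q ⊕ Q)) refl (p x) (q x) (all? p l) (all? q l)

-- Injective sequences under upper bounds

module Placements (N : ℕ) where

  avoids : List (Fin N) → Fin N → Bool
  avoids E y = all? (λ e → not (toℕ e ≡ᵇ toℕ y)) E

  allBelow : List ℕ → List (Fin N) → Bool
  allBelow [] [] = true
  allBelow (β ∷ βs) (x ∷ l) = below β x ∧ allBelow βs l
  allBelow _ _ = false

  placement : List (Fin N) → List ℕ → List (Fin N) → Bool
  placement E βs l = all? (avoids E) l ∧ distinct l ∧ allBelow βs l

  placements : List (Fin N) → List ℕ → ℕ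
  placements E [] = 1
  placements E (β ∷ βs) = sum (map (λ x → if below β x ∧ avoids E x then placements (x ∷ E) βs else 0) (allFin N))

  placement-cons : ∀ E β βs x l → placement E (β ∷ βs) (x ∷ l) ≡ (below β x ∧ avoids E x) ∧ placement (x ∷ E) βs l
  placement-cons E β βs x l rewrite all?-∧ (λ y → not (toℕ x ≡ᵇ toℕ y)) (avoids E) l =
    solve 6 (λ p q r s t u → (p ⊕ q) ⊕ (r ⊕ s) ⊕ (t ⊕ u) ⊜ (t ⊕ p) ⊕ ((r ⊕ q) ⊕ s ⊕ u)) refl
      (avoids E x) (all? (avoids E) l) (all? (λ y → not (toℕ x ≡ᵇ toℕ y)) l) (distinct l) (below β x) (allBelow βs l)

  count-placements : ∀ E βs m → length βs ≡ m → cnt (λ σ → placement E βs (toList σ)) (allVecs N m) ≡ placements E βs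
  count-placements E [] zero _ = refl
  count-placements E (β ∷ βs) (suc m) len =
    trans (cnt-concatMap _ (λ x → map (x ∷_) (allVecs N m)) (allFin N)) (sum-cong first (allFin N))
    where
    first : ∀ x → cnt (λ σ → placement E (β ∷ βs) (toList σ)) (map (x ∷_) (allVecs N m))
                  ≡ (if below β x ∧ avoids E x then placements (x ∷ E) βs else 0)
    first x = trans (cnt-map _ (x ∷_) (allVecs N m))
      (trans (cnt-cong (λ σ → placement-cons E β βs x (toList σ)) (allVecs N m))
      (trans (cnt-guard (below β x ∧ avoids E x) (λ σ → placement (x ∷ E) βs (toList σ)) (allVecs N m))
      (cong (λ z → if below β x ∧ avoids E x then z else 0) (count-placements (x ∷ E) βs m (suc-injective len)))))

  placements-avoid-cong : ∀ E E' → (∀ y → avoids E y ≡ avoids E' y) → ∀ βs → placements E βs ≡ placements E' βs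
  placements-avoid-cong E E' e [] = refl
  placements-avoid-cong E E' e (β ∷ βs) = sum-cong (λ x → cong₂ (λ u v → if below β x ∧ u then v else 0) (e x)
    (placements-avoid-cong (x ∷ E) (x ∷ E') (λ y → cong (not (toℕ x ≡ᵇ toℕ y) ∧_) (e y)) βs)) (allFin N)

  -- Swapping two adjacent bounds: the double sum over the first two values is symmetric.
  placements-swap : ∀ E β γ βs βs' → (∀ E' → placements E' βs ≡ placements E' βs') →
    placements E (β ∷ γ ∷ βs) ≡ placements E (γ ∷ β ∷ βs')
  placements-swap E β γ βs βs' ih =
    trans (sum-cong (λ x → sum-guard (below β x ∧ avoids E x) _ (allFin N)) (allFin N))
    (trans (sum-cong (λ x → sum-cong (λ y → pointwise x y) (allFin N)) (allFin N))
    (trans (sum-swap (λ x y → term y x) (allFin N) (allFin N))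
    (sym (sum-cong (λ y → sum-guard (below γ y ∧ avoids E y) _ (allFin N)) (allFin N)))))
    where
    avoid-swap : ∀ p q r → p ∧ (q ∧ r) ≡ q ∧ (p ∧ r)
    avoid-swap = solve 3 (λ p q r → p ⊕ (q ⊕ r) ⊜ q ⊕ (p ⊕ r)) refl
    term : Fin N → Fin N → ℕ
    term y x = if below γ y ∧ avoids E y then (if below β x ∧ avoids (y ∷ E) x then placements (x ∷ y ∷ E) βs' else 0) else 0
    pointwise : ∀ x y → (if below β x ∧ avoids E x then (if below γ y ∧ avoids (x ∷ E) y then placements (y ∷ x ∷ E) βs else 0) else 0)
                        ≡ term y x
    pointwise x y rewrite guard-guard (below β x ∧ avoids E x) (below γ y ∧ avoids (x ∷ E) y) (placements (y ∷ x ∷ E) βs)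
      | guard-guard (below γ y ∧ avoids E y) (below β x ∧ avoids (y ∷ E) x) (placements (x ∷ y ∷ E) βs')
      | ih (y ∷ x ∷ E) | ≡ᵇ-sym (toℕ y) (toℕ x)
      | placements-avoid-cong (y ∷ x ∷ E) (x ∷ y ∷ E) (λ z → avoid-swap (not (toℕ y ≡ᵇ toℕ z)) (not (toℕ x ≡ᵇ toℕ z)) (avoids E z)) βs'
      | solve 5 (λ p q r s t → (p ⊕ q) ⊕ (r ⊕ (t ⊕ s)) ⊜ (r ⊕ s) ⊕ (p ⊕ (t ⊕ q))) refl
          (below β x) (avoids E x) (below γ y) (avoids E y) (not (toℕ x ≡ᵇ toℕ y)) = refl

  placements-↭ : ∀ {βs βs'} → βs ↭ βs' → ∀ E → placements E βs ≡ placements E βs'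
  placements-↭ ↭-refl E = refl
  placements-↭ (prep β p) E = sum-cong (λ x → cong (λ z → if below β x ∧ avoids E x then z else 0) (placements-↭ p (x ∷ E))) (allFin N)
  placements-↭ (↭-trans p q) E = trans (placements-↭ p E) (placements-↭ q E)
  placements-↭ {β ∷ γ ∷ βs} {.γ ∷ .β ∷ βs'} (swap .β .γ p) E = placements-swap E β γ βs βs' (placements-↭ p)

  free : List (Fin N) → ℕ → ℕ
  free E β = cnt (λ y → below β y ∧ avoids E y) (allFin N)

  free-use : ∀ E β x → below β x ≡ true → avoids E x ≡ true → free E β ≡ suc (free (x ∷ E) β)
  free-use E β x x≤β x∉E =
    trans (cnt-cong split (allFin N))
    (trans (cnt-or (λ y → toℕ x ≡ᵇ toℕ y) (λ y → below β y ∧ avoids (x ∷ E) y) exclusive (allFin N))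
    (cong (_+ free (x ∷ E) β) (cnt-equal x)))
    where
    split : ∀ y → (below β y ∧ avoids E y) ≡ ((toℕ x ≡ᵇ toℕ y) ∨ (below β y ∧ avoids (x ∷ E) y))
    split y with toℕ x ≡ᵇ toℕ y in eq
    ... | true rewrite toℕ-injective (≡ᵇ-sound (toℕ x) (toℕ y) eq) | x≤β | x∉E = refl
    ... | false with below β y
    ...   | true = refl
    ...   | false = refl
    exclusive : ∀ y → (toℕ x ≡ᵇ toℕ y) ∧ (below β y ∧ avoids (x ∷ E) y) ≡ false
    exclusive y with toℕ x ≡ᵇ toℕ y
    ... | false = refl
    ... | true = ∧-zeroʳ (below β y)

  -- The product Π_i (free E β_i − (d + i)): the i-th value has d + i fewer choices.
  product : List (Fin N) → List ℕ → ℕ → ℕ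
  product E [] d = 1
  product E (β ∷ βs) d = (free E β ∸ d) * product E βs (suc d)

  product-use : ∀ E x βs d → avoids E x ≡ true → All (λ β → below β x ≡ true) βs → product (x ∷ E) βs d ≡ product E βs (suc d)
  product-use E x [] d x∉E _ = refl
  product-use E x (β ∷ βs) d x∉E (x≤β ∷ rest) rewrite free-use E β x x≤β x∉E =
    cong ((free (x ∷ E) β ∸ d) *_) (product-use E x βs (suc d) x∉E rest)

  Sorted : List ℕ → Set
  Sorted [] = ⊤
  Sorted (β ∷ βs) = All (β ≤_) βs × Sorted βs

  -- For increasing bounds the first value has free E β choices, and each choice removes one
  -- option from every later (larger) bound: the count is the product.
  placements-sorted : ∀ E βs → Sorted βs → placements E βs ≡ product E βs 0
  placements-sorted E [] _ = refl
  placements-sorted E (β ∷ βs) (β≤ , sorted) =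
    trans (sum-cong choice (allFin N)) (sum-guarded-const (λ x → below β x ∧ avoids E x) (product E βs 1) (allFin N))
    where
    choice : ∀ x → (if below β x ∧ avoids E x then placements (x ∷ E) βs else 0) ≡ (if below β x ∧ avoids E x then product E βs 1 else 0)
    choice x with below β x in x≤β | avoids E x in x∉E
    ... | true | true = trans (placements-sorted (x ∷ E) βs sorted) (product-use E x βs 0 x∉E (All.map (below-mono x x≤β) β≤))
    ... | true | false = refl
    ... | false | _ = refl

-- [v] for words without the letter b

NoB : List Letter3 → Set
NoB [] = ⊤
NoB (A ∷ v) = NoB v
NoB (B ∷ v) = ⊥
NoB (AB ∷ v) = NoB v

Fℕ : ℕ → List Letter3 → ℕ
Fℕ s [] = s
Fℕ s (A ∷ v) = s * Fℕ s v
Fℕ s (B ∷ v) = 0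
Fℕ s (AB ∷ v) = s * Fℕ (suc s) v

Fℕ-F : ∀ s v → NoB v → + Fℕ s v ≡ F s v
Fℕ-F s [] _ = refl
Fℕ-F s (A ∷ v) noB = trans (ℤP.pos-* s (Fℕ s v)) (cong (+ s ℤ.*_) (Fℕ-F s v noB))
Fℕ-F s (AB ∷ v) noB = trans (ℤP.pos-* s (Fℕ (suc s) v)) (cong (+ s ℤ.*_) (Fℕ-F (suc s) v noB))

excLetter : ∀ {n} → ℕ → Fin n → Letter
excLetter k x = if k <ᵇ toℕ x then b else a

excLetters : ∀ {n} → ℕ → List (Fin n) → List Letter
excLetters k [] = []
excLetters k (x ∷ xs) = excLetter k x ∷ excLetters (suc k) xs

excLetters-lookup : ∀ {n m} (σ : Vec (Fin n) m) k → map (λ i → excLetter (k + toℕ i) (lookup σ i)) (allFin m) ≡ excLetters k (toList σ)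
excLetters-lookup [] k = refl
excLetters-lookup {n} {suc m} (x ∷ σ) k = cong₂ _∷_ (cong (λ z → excLetter z x) (+-identityʳ k))
  (trans (map-tabulate fsuc (λ i → excLetter (k + toℕ i) (lookup (x ∷ σ) i)))
  (trans (tabulate-cong (λ i → cong (λ z → excLetter z (lookup σ i)) (+-suc k (toℕ i))))
  (trans (sym (map-tabulate (λ i → i) (λ i → excLetter (suc k + toℕ i) (lookup σ i))))
  (excLetters-lookup σ (suc k)))))

-- The upper bounds σ(i) ≤ β_i expressing compatibility with a word v without b, from
-- position i on: a letter a at i forces σ(i) ≤ i; a letter a+b and the last position are free.
bounds : ℕ → ℕ → List Letter3 → List ℕ
bounds n i [] = [ n ]
bounds n i (A ∷ v) = i ∷ bounds n (suc i) v
bounds n i (B ∷ v) = i ∷ bounds n (suc i) v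
bounds n i (AB ∷ v) = n ∷ bounds n (suc i) v

length-bounds : ∀ n i v → length (bounds n i v) ≡ suc (length v)
length-bounds n i [] = refl
length-bounds n i (A ∷ v) = cong suc (length-bounds n (suc i) v)
length-bounds n i (B ∷ v) = cong suc (length-bounds n (suc i) v)
length-bounds n i (AB ∷ v) = cong suc (length-bounds n (suc i) v)

compat-bounds : ∀ n k v (xs : List (Fin n)) → NoB v → length xs ≡ suc (length v) →
  compat v (take (length v) (excLetters k xs)) ≡ Placements.allBelow n (bounds n k v) xs
compat-bounds n k [] (x ∷ []) _ _ rewrite below-top n x = refl
compat-bounds n k (A ∷ v) (x ∷ xs) noB len with k <ᵇ toℕ x
... | true = refl
... | false = compat-bounds n (suc k) v xs noB (suc-injective len)
compat-bounds n k (AB ∷ v) (x ∷ xs) noB len rewrite below-top n x with excLetter k x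
... | a = compat-bounds n (suc k) v xs noB (suc-injective len)
... | b = compat-bounds n (suc k) v xs noB (suc-injective len)

-- The same bounds in increasing order: the bounds i of the letters a, followed by the
-- g+1 free bounds n (g counts the letters a+b met so far).
sortedBounds : ℕ → ℕ → List Letter3 → ℕ → List ℕ
sortedBounds n i [] g = replicate (suc g) n
sortedBounds n i (A ∷ v) g = i ∷ sortedBounds n (suc i) v g
sortedBounds n i (B ∷ v) g = i ∷ sortedBounds n (suc i) v g
sortedBounds n i (AB ∷ v) g = sortedBounds n (suc i) v (suc g)

bounds-↭ : ∀ n i v g → NoB v → bounds n i v ++ replicate g n ↭ sortedBounds n i v g
bounds-↭ n i [] g _ = ↭-refl
bounds-↭ n i (A ∷ v) g noB = prep i (bounds-↭ n (suc i) v g noB)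
bounds-↭ n i (AB ∷ v) g noB = ↭-trans (↭-sym (shift n (bounds n (suc i) v) (replicate g n))) (bounds-↭ n (suc i) v (suc g) noB)

replicate-above : ∀ j n k → j ≤ n → All (j ≤_) (replicate k n)
replicate-above j n zero le = []
replicate-above j n (suc k) le = le ∷ replicate-above j n k le

sortedBounds-above : ∀ n j i v g → j ≤ i → j ≤ n → All (j ≤_) (sortedBounds n i v g)
sortedBounds-above n j i [] g j≤i j≤n = replicate-above j n (suc g) j≤n
sortedBounds-above n j i (A ∷ v) g j≤i j≤n = j≤i ∷ sortedBounds-above n j (suc i) v g (m≤n⇒m≤1+n j≤i) j≤n
sortedBounds-above n j i (B ∷ v) g j≤i j≤n = j≤i ∷ sortedBounds-above n j (suc i) v g (m≤n⇒m≤1+n j≤i) j≤n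
sortedBounds-above n j i (AB ∷ v) g j≤i j≤n = sortedBounds-above n j (suc i) v (suc g) (m≤n⇒m≤1+n j≤i) j≤n

replicate-sorted : ∀ n k → Placements.Sorted n (replicate k n)
replicate-sorted n zero = tt
replicate-sorted n (suc k) = replicate-above n n k ≤-refl , replicate-sorted n k

sortedBounds-sorted : ∀ n i v g → i + length v ≤ n → Placements.Sorted n (sortedBounds n i v g)
sortedBounds-sorted n i [] g le = replicate-sorted n (suc g)
sortedBounds-sorted n i (A ∷ v) g le =
  sortedBounds-above n i (suc i) v g (n≤1+n i) (≤-trans (m≤m+n i _) le) , sortedBounds-sorted n (suc i) v g (subst (_≤ n) (+-suc i (length v)) le)
sortedBounds-sorted n i (B ∷ v) g le =
  sortedBounds-above n i (suc i) v g (n≤1+n i) (≤-trans (m≤m+n i _) le) , sortedBounds-sorted n (suc i) v g (subst (_≤ n) (+-suc i (length v)) le)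
sortedBounds-sorted n i (AB ∷ v) g le = sortedBounds-sorted n (suc i) v (suc g) (subst (_≤ n) (+-suc i (length v)) le)

free-empty : ∀ n β → Placements.free n [] β ≡ n ⊓ suc β
free-empty n β = trans (cnt-cong (λ y → ∧-identityʳ (below β y)) (allFin n)) (cnt-below n β)

∸-of-sum : ∀ m d g → m ≡ d + g → m ∸ d ≡ g
∸-of-sum m d g e = trans (cong (_∸ d) e) (m+n∸m≡n d g)

-- The free bounds contribute (g+1)!: the d-th of them has n − d = g+1, g, … choices.
product-free : ∀ n g d → n ≡ d + g → Placements.product n [] (replicate g n) d ≡ g !
product-free n zero d e = refl
product-free n (suc g) d e rewrite free-empty n n | m≤n⇒m⊓n≡m (n≤1+n n) =
  cong₂ _*_ (∸-of-sum n d (suc g) e) (product-free n g (suc d) (trans e (+-suc d g)))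

position<n : ∀ n (v : List Letter3) i g d → n ≡ d + suc g + suc (length v) → suc i ≡ d + suc g → suc i ≤ n
position<n n v i g d e₁ e₂ = subst (suc i ≤_) (sym e₁) (subst (_≤ d + suc g + suc (length v)) (sym e₂) (m≤m+n (d + suc g) (suc (length v))))

-- Evaluation of the product for the sorted bounds: d bounds have been used, g+1 of the
-- values are still free, and i is the current position.
product-sortedBounds : ∀ n v i g d → NoB v → n ≡ d + suc g + length v → suc i ≡ d + suc g →
  Placements.product n [] (sortedBounds n i v g) d ≡ Fℕ (suc g) v * g !
product-sortedBounds n [] i g d _ e₁ e₂ = product-free n (suc g) d (trans e₁ (+-identityʳ _))
product-sortedBounds n (A ∷ v) i g d noB e₁ e₂ rewrite free-empty n i | m≥n⇒m⊓n≡n (position<n n v i g d e₁ e₂) =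
  trans (cong₂ _*_ (∸-of-sum (suc i) d (suc g) e₂)
                   (product-sortedBounds n v (suc i) g (suc d) noB (trans e₁ (+-suc (d + suc g) (length v))) (cong suc e₂)))
        (sym (*-assoc (suc g) (Fℕ (suc g) v) (g !)))
product-sortedBounds n (AB ∷ v) i g d noB e₁ e₂ =
  trans (product-sortedBounds n v (suc i) (suc g) d noB
           (trans e₁ (trans (+-suc (d + suc g) (length v)) (cong (_+ length v) (sym (+-suc d (suc g))))))
           (trans (cong suc e₂) (sym (+-suc d (suc g)))))
        (reassoc (Fℕ (suc (suc g)) v) (suc g) (g !))
  where
  reassoc : ∀ x y z → x * (y * z) ≡ (y * x) * z
  reassoc x y z = trans (sym (*-assoc x y z)) (cong (_* z) (*-comm x y))

length-toList : ∀ {X : Set} {m} (σ : Vec X m) → length (toList σ) ≡ m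
length-toList [] = refl
length-toList (x ∷ σ) = cong suc (length-toList σ)

-- [v] = F 1 v for words without b: the compatible permutations are the placements for
-- the bounds of v, counted after sorting the bounds.
countS-noB : ∀ n' v → NoB v → length v ≡ n' → countS (suc n') v ≡ Fℕ 1 v
countS-noB n' v noB len = begin
  countS n v
    ≡⟨ cnt-filter (λ σ → compat v (excWordS σ)) isPerm (allVecs n n) ⟩
  cnt (λ σ → isPerm σ ∧ compat v (excWordS σ)) (allVecs n n)
    ≡⟨ cnt-cong as-placement (allVecs n n) ⟩
  cnt (λ σ → placement [] (bounds n 0 v) (toList σ)) (allVecs n n)
    ≡⟨ count-placements [] (bounds n 0 v) n (trans (length-bounds n 0 v) (cong suc len)) ⟩
  placements [] (bounds n 0 v)
    ≡⟨ cong (placements []) (sym (++-identityʳ (bounds n 0 v))) ⟩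
  placements [] (bounds n 0 v ++ [])
    ≡⟨ placements-↭ (bounds-↭ n 0 v 0 noB) [] ⟩
  placements [] (sortedBounds n 0 v 0)
    ≡⟨ placements-sorted [] (sortedBounds n 0 v 0) (sortedBounds-sorted n 0 v 0 (subst (_≤ n) (sym len) (n≤1+n n'))) ⟩
  product [] (sortedBounds n 0 v 0) 0
    ≡⟨ product-sortedBounds n v 0 0 0 noB (cong suc (sym len)) refl ⟩
  Fℕ 1 v * 1
    ≡⟨ *-identityʳ (Fℕ 1 v) ⟩
  Fℕ 1 v ∎
  where
  open ≡-Reasoning
  n = suc n'
  open Placements n
  as-placement : ∀ (σ : Vec (Fin n) n) → (isPerm σ ∧ compat v (excWordS σ)) ≡ placement [] (bounds n 0 v) (toList σ)
  as-placement σ rewrite all?-intro (λ _ → true) (toList σ) (λ _ → refl) | excLetters-lookup σ 0 =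
    cong (distinct (toList σ) ∧_) (trans (cong (λ m → compat v (take m (excLetters 0 (toList σ)))) (sym len))
      (compat-bounds n 0 v (toList σ) noB (trans (length-toList σ) (cong suc (sym len)))))

-- Inclusion–exclusion on the letter b, and part (2)

admits : Letter3 → Letter → Bool
admits A a = true
admits A b = false
admits B a = false
admits B b = true
admits AB _ = true

compat-cons : ∀ x vs u us → compat (x ∷ vs) (u ∷ us) ≡ admits x u ∧ compat vs us
compat-cons A vs a us = refl
compat-cons A vs b us = refl
compat-cons B vs a us = refl
compat-cons B vs b us = refl
compat-cons AB vs a us = refl
compat-cons AB vs b us = refl

compat-split : ∀ p q u → compat (p ++ AB ∷ q) u ≡ (compat (p ++ A ∷ q) u ∨ compat (p ++ B ∷ q) u)
compat-split [] q [] = refl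
compat-split [] q (a ∷ us) = sym (∨-identityʳ _)
compat-split [] q (b ∷ us) = refl
compat-split (A ∷ p) q [] = refl
compat-split (B ∷ p) q [] = refl
compat-split (AB ∷ p) q [] = refl
compat-split (x ∷ p) q (u ∷ us) rewrite compat-cons x (p ++ AB ∷ q) u us | compat-cons x (p ++ A ∷ q) u us
  | compat-cons x (p ++ B ∷ q) u us | compat-split p q us = ∧-distribˡ-∨ (admits x u) _ _

compat-exclusive : ∀ p q u → (compat (p ++ A ∷ q) u ∧ compat (p ++ B ∷ q) u) ≡ false
compat-exclusive [] q [] = refl
compat-exclusive [] q (a ∷ us) = ∧-zeroʳ (compat q us)
compat-exclusive [] q (b ∷ us) = refl
compat-exclusive (A ∷ p) q [] = refl
compat-exclusive (B ∷ p) q [] = refl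
compat-exclusive (AB ∷ p) q [] = refl
compat-exclusive (x ∷ p) q (u ∷ us) rewrite compat-cons x (p ++ A ∷ q) u us | compat-cons x (p ++ B ∷ q) u us
  with admits x u
... | true = compat-exclusive p q us
... | false = refl

countS-split : ∀ n p q → countS n (p ++ AB ∷ q) ≡ countS n (p ++ A ∷ q) + countS n (p ++ B ∷ q)
countS-split n p q =
  trans (cnt-cong (λ σ → compat-split p q (excWordS σ)) perms)
    (cnt-or (λ σ → compat (p ++ A ∷ q) (excWordS σ)) (λ σ → compat (p ++ B ∷ q) (excWordS σ))
      (λ σ → compat-exclusive p q (excWordS σ)) perms)
  where perms = filterᵇ isPerm (allVecs n n)

NoB-++ : ∀ p q → NoB p → NoB q → NoB (p ++ q)
NoB-++ [] q _ noB = noB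
NoB-++ (A ∷ p) q noBp noBq = NoB-++ p q noBp noBq
NoB-++ (AB ∷ p) q noBp noBq = NoB-++ p q noBp noBq

length-replace : ∀ (p q : List Letter3) x y → length (p ++ x ∷ q) ≡ length (p ++ y ∷ q)
length-replace [] q x y = refl
length-replace (z ∷ p) q x y = cong suc (length-replace p q x y)

-- Scan v = p ++ q from left to right keeping the prefix p free of b; each b met is
-- eliminated by inclusion–exclusion, which F obeys as well (F-split).
countS-F-scan : ∀ n' q p → NoB p → length (p ++ q) ≡ n' → + countS (suc n') (p ++ q) ≡ F 1 (p ++ q)
countS-F-shift : ∀ n' q p x → NoB [ x ] → NoB p → length (p ++ x ∷ q) ≡ n' → + countS (suc n') (p ++ x ∷ q) ≡ F 1 (p ++ x ∷ q)

countS-F-scan n' [] p noB len rewrite ++-identityʳ p = trans (cong +_ (countS-noB n' p noB len)) (Fℕ-F 1 p noB)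
countS-F-scan n' (A ∷ q) p noB len = countS-F-shift n' q p A tt noB len
countS-F-scan n' (AB ∷ q) p noB len = countS-F-shift n' q p AB tt noB len
countS-F-scan n' (B ∷ q) p noB len = begin
  + countS n (p ++ B ∷ q)
    ≡⟨ difference (countS n (p ++ A ∷ q)) (countS n (p ++ B ∷ q)) ⟩
  + (countS n (p ++ A ∷ q) + countS n (p ++ B ∷ q)) ℤ.- + countS n (p ++ A ∷ q)
    ≡⟨ cong (λ z → + z ℤ.- + countS n (p ++ A ∷ q)) (sym (countS-split n p q)) ⟩
  + countS n (p ++ AB ∷ q) ℤ.- + countS n (p ++ A ∷ q)
    ≡⟨ cong₂ ℤ._-_ (countS-F-shift n' q p AB tt noB (trans (length-replace p q AB B) len))
                   (countS-F-shift n' q p A tt noB (trans (length-replace p q A B) len)) ⟩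
  F 1 (p ++ AB ∷ q) ℤ.- F 1 (p ++ A ∷ q)
    ≡⟨ sym (F-split p q 1) ⟩
  F 1 (p ++ B ∷ q) ∎
  where
  open ≡-Reasoning
  n = suc n'
  difference : ∀ x y → + y ≡ + (x + y) ℤ.- + x
  difference x y rewrite ℤP.pos-+ x y = ring (+ x) (+ y)
    where ring : ∀ u w → w ≡ (u ℤ.+ w) ℤ.- u
          ring = solve-∀

countS-F-shift n' q p x noBx noBp len = subst (λ v → + countS (suc n') v ≡ F 1 v) assoc
  (countS-F-scan n' q (p ++ [ x ]) (NoB-++ p [ x ] noBp noBx) (trans (cong length assoc) len))
  where assoc = ++-assoc p [ x ] q

countS-F : ∀ n' v → length v ≡ n' → + countS (suc n') v ≡ F 1 v
countS-F n' v len = countS-F-scan n' v [] tt len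

-- Shape of the columns of M(π)

-- The entry t^j of a column with color c whose (uncolored) excedance letter is u:
-- for c = 0 it is u; for c > 0 it is a for the top colors j < r − c and b below.
shape : ℕ → ℕ → Letter → ℕ → Letter
shape r zero u j = u
shape r (suc c) u j = if j + suc c <ᵇ r then a else b

excLetterAt : ∀ {n} → Vec (Fin n) n → Fin n → Letter
excLetterAt σ i = excLetter (toℕ i) (lookup σ i)

-- For π = (σ , c) and j < r: t_i^j = shape r c_i u_i j.  If i^[j] ↦ σ(i)^[j + c_i mod r]
-- wraps around (j + c_i ≥ r) the color decreases, which is an excedance in the color order.
entry-shape : ∀ r' {n} (σ : Vec (Fin n) n) (c : Vec (Fin (suc r')) n) (i : Fin n) j → j < suc r' →
  entry (suc r') (σ , c) i j ≡ shape (suc r') (toℕ (lookup c i)) (excLetterAt σ i) j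
entry-shape r' σ c i j j<r = go (toℕ (lookup c i)) (lookup σ i) (toℕ<n (lookup c i))
  where
  r = suc r'
  go : ∀ ci x → ci < r → (if colorLess (i , j) (x , (j + ci) % r) then b else a) ≡ shape r ci (excLetter (toℕ i) x) j
  go zero x _ rewrite +-identityʳ j | m<n⇒m%n≡m j<r | <ᵇ-false {j} {j} ≤-refl | ≡ᵇ-refl j = refl
  go (suc ci) x ci<r with j + suc ci <? r
  ... | yes no-wrap rewrite m<n⇒m%n≡m no-wrap | <ᵇ-false {j + suc ci} {j} (m≤m+n j (suc ci))
    | ≡ᵇ-false (<⇒≢ (m<m+n j {suc ci} z<s)) | <ᵇ-true no-wrap = refl
  ... | no wrap rewrite <ᵇ-false {j + suc ci} {r} (≮⇒≥ wrap) = wrapped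
    where
    k = j + suc ci ∸ r
    j+ci≡k+r : j + suc ci ≡ k + r
    j+ci≡k+r = sym (m∸n+n≡m (≮⇒≥ wrap))
    k<j : k < j
    k<j = +-cancelʳ-< r k j (subst (_< j + r) j+ci≡k+r (+-monoʳ-< j ci<r))
    mod-shift : (k + r) % r ≡ k % r
    mod-shift = [m+n]%n≡m%n k r
    wrapped : (if colorLess (i , j) (x , (j + suc ci) % r) then b else a) ≡ b
    wrapped rewrite j+ci≡k+r | mod-shift | m<n⇒m%n≡m (<-trans k<j j<r) | <ᵇ-true k<j = refl

a≢b : a ≢ b
a≢b ()

separating-row : ∀ r' c c' → c < c' → c' < r' →
  Σ ℕ λ j → j < suc r' × (j + suc c <ᵇ suc r') ≡ true × (j + suc c' <ᵇ suc r') ≡ false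
separating-row r' c c' c<c' c'<r' = r' ∸ c' , s≤s (m∸n≤m r' c') , <ᵇ-true below-r , <ᵇ-false (≤-reflexive (sym at-r))
  where
  at-r : r' ∸ c' + suc c' ≡ suc r'
  at-r = trans (+-suc (r' ∸ c') c') (cong suc (m∸n+n≡m (<⇒≤ c'<r')))
  below-r : r' ∸ c' + suc c < suc r'
  below-r = subst (r' ∸ c' + suc c <_) at-r (+-monoʳ-< (r' ∸ c') (s≤s c<c'))

shape-top : ∀ r' c u → suc c < suc r' → shape (suc r') (suc c) u 0 ≡ a
shape-top r' c u lt rewrite <ᵇ-true lt = refl

shape-bottom : ∀ r' c u → shape (suc r') (suc c) u r' ≡ b
shape-bottom r' c u rewrite <ᵇ-false {r' + suc c} {suc r'} (≤-trans (s≤s (m≤m+n r' c)) (≤-reflexive (sym (+-suc r' c)))) = refl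

SameColumn : ℕ → ℕ → Letter → ℕ → Letter → Set
SameColumn r' c u c' u' = ∀ j → j < suc r' → shape (suc r') c u j ≡ shape (suc r') c' u' j

SameColumn-sym : ∀ r' c u c' u' → SameColumn r' c u c' u' → SameColumn r' c' u' c u
SameColumn-sym r' c u c' u' same j j<r = sym (same j j<r)

-- A constant column differs from a column of nonzero color, which contains both letters.
constant≢colored : ∀ r' c u u' → suc c < suc r' → ¬ SameColumn r' zero u (suc c) u'
constant≢colored r' c u u' c<r same =
  a≢b (trans (sym (trans (same 0 z<s) (shape-top r' c u' c<r))) (trans (same r' ≤-refl) (shape-bottom r' c u')))

colored≢colored : ∀ r' c c' u u' → c < c' → c' < r' → ¬ SameColumn r' (suc c) u (suc c') u'
colored≢colored r' c c' u u' c<c' c'<r' same with separating-row r' c c' c<c' c'<r'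
... | j , j<r , top , bottom =
  a≢b (trans (cong (λ z → if z then a else b) (sym top)) (trans (same j j<r) (cong (λ z → if z then a else b) bottom)))

column-determines : ∀ r' c c' u u' → c < suc r' → c' < suc r' → SameColumn r' c u c' u' → (c ≡ c') × (c ≡ 0 → u ≡ u')
column-determines r' zero zero u u' _ _ same = refl , λ _ → same 0 z<s
column-determines r' zero (suc c') u u' _ c'<r same = ⊥-elim (constant≢colored r' c' u u' c'<r same)
column-determines r' (suc c) zero u u' c<r _ same = ⊥-elim (constant≢colored r' c u' u c<r (SameColumn-sym r' (suc c) u zero u' same))
column-determines r' (suc c) (suc c') u u' c<r c'<r same with <-cmp c c'
... | tri≈ _ refl _ = refl , λ ()
... | tri< c<c' _ _ = ⊥-elim (colored≢colored r' c c' u u' c<c' (≤-pred c'<r) same)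
... | tri> _ _ c'<c = ⊥-elim (colored≢colored r' c' c u' u c'<c (≤-pred c<r) (SameColumn-sym r' (suc c) u (suc c') u' same))

shape-cong : ∀ r c u u' j → (c ≡ 0 → u ≡ u') → shape r c u j ≡ shape r c u' j
shape-cong r zero u u' j same = same refl
shape-cong r (suc c) u u' j same = refl

fullWord : ∀ r .{{_ : NonZero r}} {n} → ColPerm r n → List Letter
fullWord r π = concatMap (row r π) (reverse (upTo r))

take-prefix : {X : Set} (k : ℕ) (xs ys : List X) → k ≡ length xs → take k (xs ++ ys) ≡ xs
take-prefix _ [] ys refl = refl
take-prefix _ (x ∷ xs) ys refl = cong (x ∷_) (take-prefix (length xs) xs ys refl)

length-concatMap-const : {X Y : Set} (f : X → List Y) (m : ℕ) → (∀ x → length (f x) ≡ m) → (l : List X) →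
  length (concatMap f l) ≡ length l * m
length-concatMap-const f m len [] = refl
length-concatMap-const f m len (x ∷ l) = trans (length-++ (f x)) (cong₂ _+_ (len x) (length-concatMap-const f m len l))

length-allFin : ∀ n → length (allFin n) ≡ n
length-allFin n = length-tabulate (λ i → i)

allFin-snoc : ∀ n → allFin (suc n) ≡ map inject₁ (allFin n) ∷ʳ fromℕ n
allFin-snoc zero = refl
allFin-snoc (suc n) = cong (fzero ∷_) (begin
  tabulate fsuc                                              ≡⟨ sym (map-tabulate (λ i → i) fsuc) ⟩
  map fsuc (allFin (suc n))                                  ≡⟨ cong (map fsuc) (allFin-snoc n) ⟩
  map fsuc (map inject₁ (allFin n) ∷ʳ fromℕ n)               ≡⟨ map-++ fsuc (map inject₁ (allFin n)) [ fromℕ n ] ⟩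
  map fsuc (map inject₁ (allFin n)) ∷ʳ fsuc (fromℕ n)        ≡⟨ cong (_∷ʳ fsuc (fromℕ n)) (trans (sym (map-∘ (allFin n))) (map-∘ (allFin n))) ⟩
  map inject₁ (map fsuc (allFin n)) ∷ʳ fsuc (fromℕ n)        ≡⟨ cong (λ l → map inject₁ l ∷ʳ fsuc (fromℕ n)) (map-tabulate (λ i → i) fsuc) ⟩
  map inject₁ (tabulate fsuc) ∷ʳ fsuc (fromℕ n)              ∎)
  where open ≡-Reasoning

take-allFin : ∀ n' → take n' (allFin (suc n')) ≡ map inject₁ (allFin n')
take-allFin n' = trans (cong (take n') (allFin-snoc n'))
  (take-prefix n' (map inject₁ (allFin n')) [ fromℕ n' ] (sym (trans (length-map inject₁ (allFin n')) (length-allFin n'))))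

length-row : ∀ r .{{_ : NonZero r}} {n} (π : ColPerm r n) j → length (row r π j) ≡ n
length-row r {n} π j = trans (length-map _ (allFin n)) (length-allFin n)

excLetterAt-last : ∀ n' (σ : Vec (Fin (suc n')) (suc n')) → excLetterAt σ (fromℕ n') ≡ a
excLetterAt-last n' σ rewrite toℕ-fromℕ n' | <ᵇ-false {n'} {toℕ (lookup σ (fromℕ n'))} (≤-pred (toℕ<n (lookup σ (fromℕ n')))) = refl

entry-last : ∀ r' n' (π : ColPerm (suc r') (suc n')) → entry (suc r') π (fromℕ n') 0 ≡ a
entry-last r' n' (σ , c) = trans (entry-shape r' σ c (fromℕ n') 0 z<s) (bottom-right (toℕ (lookup c (fromℕ n'))) (toℕ<n (lookup c (fromℕ n'))))
  where
  bottom-right : ∀ ci → ci < suc r' → shape (suc r') ci (excLetterAt σ (fromℕ n')) 0 ≡ a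
  bottom-right zero _ = excLetterAt-last n' σ
  bottom-right (suc ci) lt = shape-top r' ci (excLetterAt σ (fromℕ n')) lt

fullWord-excWord : ∀ r' n' (π : ColPerm (suc r') (suc n')) → fullWord (suc r') π ≡ excWord (suc r') π ++ [ a ]
fullWord-excWord r' n' π = trans split (cong (_++ [ a ]) (sym (trans (cong (take (n' + r' * n)) split)
  (take-prefix (n' + r' * n) (upper ++ lastRow) [ a ] length-prefix))))
  where
  r = suc r'
  n = suc n'
  upper = concatMap (row r π) (reverse (applyUpTo suc r'))
  lastRow = map (λ i → entry r π i 0) (map inject₁ (allFin n'))
  row0 : row r π 0 ≡ lastRow ++ [ a ]
  row0 = trans (cong (map (λ i → entry r π i 0)) (allFin-snoc n'))
    (trans (map-++ (λ i → entry r π i 0) (map inject₁ (allFin n')) [ fromℕ n' ]) (cong (λ z → lastRow ++ [ z ]) (entry-last r' n' π)))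
  split : fullWord r π ≡ (upper ++ lastRow) ++ [ a ]
  split = trans (cong (concatMap (row r π)) (unfold-reverse 0 (applyUpTo suc r')))
    (trans (concatMap-++ (row r π) (reverse (applyUpTo suc r')) [ 0 ])
    (trans (cong (upper ++_) (trans (++-identityʳ (row r π 0)) row0)) (sym (++-assoc upper lastRow [ a ]))))
  length-prefix : n' + r' * n ≡ length (upper ++ lastRow)
  length-prefix = trans (+-comm n' (r' * n)) (sym (trans (length-++ upper) (cong₂ _+_
    (trans (length-concatMap-const (row r π) n (length-row r π) (reverse (applyUpTo suc r')))
           (cong (_* n) (trans (length-reverse (applyUpTo suc r')) (length-applyUpTo suc r'))))
    (trans (length-map _ (map inject₁ (allFin n'))) (trans (length-map inject₁ (allFin n')) (length-allFin n'))))))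

++-split : {X : Set} (xs ys xs' ys' : List X) → xs ++ ys ≡ xs' ++ ys' → length xs ≡ length xs' → (xs ≡ xs') × (ys ≡ ys')
++-split [] ys [] ys' e _ = refl , e
++-split (x ∷ xs) ys (x' ∷ xs') ys' e len with ∷-injective e
... | refl , e' with ++-split xs ys xs' ys' e' (suc-injective len)
... | refl , e'' = refl , e''

concatMap-blocks : {X Y : Set} (f g : X → List Y) → (∀ x → length (f x) ≡ length (g x)) → (l : List X) →
  concatMap f l ≡ concatMap g l → All (λ x → f x ≡ g x) l
concatMap-blocks f g len [] e = []
concatMap-blocks f g len (x ∷ l) e with ++-split (f x) (concatMap f l) (g x) (concatMap g l) e (len x)
... | e₁ , e₂ = e₁ ∷ concatMap-blocks f g len l e₂

tabulate-injective : {X : Set} {n : ℕ} (f g : Fin n → X) → tabulate f ≡ tabulate g → ∀ i → f i ≡ g i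
tabulate-injective {n = suc n} f g e fzero = proj₁ (∷-injective e)
tabulate-injective {n = suc n} f g e (fsuc i) = tabulate-injective (λ i → f (fsuc i)) (λ i → g (fsuc i)) (proj₂ (∷-injective e)) i

map-allFin-injective : {X : Set} {n : ℕ} (f g : Fin n → X) → map f (allFin n) ≡ map g (allFin n) → ∀ i → f i ≡ g i
map-allFin-injective f g e = tabulate-injective f g (trans (sym (map-tabulate (λ i → i) f)) (trans e (map-tabulate (λ i → i) g)))

module _ (r' n' : ℕ) where
  private
    r = suc r'
    n = suc n'

  row-index : ∀ {j} → j < r → j ∈ reverse (upTo r)
  row-index j<r = Any.reverse⁺ (∈-upTo⁺ j<r)

  excWord-entries : (π π' : ColPerm r n) → excWord r π ≡ excWord r π' → ∀ i j → j < r → entry r π i j ≡ entry r π' i j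
  excWord-entries π π' e i j j<r = map-allFin-injective (λ i → entry r π i j) (λ i → entry r π' i j)
    (All.lookup (concatMap-blocks (row r π) (row r π') (λ x → trans (length-row r π x) (sym (length-row r π' x)))
       (reverse (upTo r)) (trans (fullWord-excWord r' n' π) (trans (cong (_++ [ a ]) e) (sym (fullWord-excWord r' n' π')))))
     (row-index j<r)) i

  entries-excWord : (π π' : ColPerm r n) → (∀ i j → j < r → entry r π i j ≡ entry r π' i j) → excWord r π ≡ excWord r π'
  entries-excWord π π' same = cong (λ rows → take (r * n ∸ 1) (concat rows)) (map-cong-local
    (All.tabulate (λ {j} j∈ → map-cong-local (All.tabulate (λ {i} _ → same i j (∈-upTo⁻ (Any.reverse⁻ j∈)))))))

-- The collapsed word Ψ(w) and part (1)

all?-const : {X : Set} (p : Letter → Bool) (u : Letter) → p u ≡ true → (l : List X) → all? p (map (λ _ → u) l) ≡ true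
all?-const p u pu [] = refl
all?-const p u pu (x ∷ l) rewrite pu = all?-const p u pu l

asLetter3 : Letter → Letter3
asLetter3 a = A
asLetter3 b = B

collapse-shape : ∀ r' ci u → ci < suc r' →
  collapse (map (shape (suc r') ci u) (upTo (suc r'))) ≡ (if ci ≡ᵇ 0 then asLetter3 u else AB)
collapse-shape r' zero a _ rewrite all?-const (_==L a) a refl (upTo (suc r')) = refl
collapse-shape r' zero b _ rewrite all?-const (_==L b) b refl (upTo (suc r')) = refl
collapse-shape r' (suc ci) u ci<r
  rewrite all?-witness (_==L a) (map (shape (suc r') (suc ci) u) (upTo (suc r'))) (∈-map⁺ _ (∈-upTo⁺ {i = r'} ≤-refl))
            (cong (_==L a) (shape-bottom r' ci u))
        | all?-witness (_==L b) (map (shape (suc r') (suc ci) u) (upTo (suc r'))) (∈-map⁺ _ (∈-upTo⁺ {i = 0} z<s))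
            (cong (_==L b) (shape-top r' ci u ci<r)) = refl

==L-sound : ∀ x y → (x ==L y) ≡ true → x ≡ y
==L-sound a a _ = refl
==L-sound b b _ = refl

==W-sound : ∀ l l' → (l ==W l') ≡ true → l ≡ l'
==W-sound [] [] _ = refl
==W-sound (x ∷ l) (y ∷ l') e with x ==L y in eq
... | true = cong₂ _∷_ (==L-sound x y eq) (==W-sound l l' e)

==W-refl : ∀ l → (l ==W l) ≡ true
==W-refl [] = refl
==W-refl (a ∷ l) = ==W-refl l
==W-refl (b ∷ l) = ==W-refl l

sameColors : ∀ {k m} → Vec (Fin k) m → Vec (Fin k) m → Bool
sameColors [] [] = true
sameColors (x ∷ xs) (y ∷ ys) = (toℕ x ≡ᵇ toℕ y) ∧ sameColors xs ys

sameColors-sound : ∀ {k m} (c c' : Vec (Fin k) m) → sameColors c c' ≡ true → c ≡ c'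
sameColors-sound [] [] _ = refl
sameColors-sound (x ∷ c) (y ∷ c') e with toℕ x ≡ᵇ toℕ y in eq
... | true = cong₂ _∷_ (toℕ-injective (≡ᵇ-sound _ _ eq)) (sameColors-sound c c' e)

sameColors-complete : ∀ {k m} (c c' : Vec (Fin k) m) → (∀ i → toℕ (lookup c i) ≡ toℕ (lookup c' i)) → sameColors c c' ≡ true
sameColors-complete [] [] _ = refl
sameColors-complete (x ∷ c) (y ∷ c') same rewrite same fzero | ≡ᵇ-refl (toℕ y) = sameColors-complete c c' (λ i → same (fsuc i))

cnt-sameColors : ∀ {k m} (d : Vec (Fin k) m) → cnt (λ c → sameColors c d) (allVecs k m) ≡ 1
cnt-sameColors [] = refl
cnt-sameColors {k} {suc m} (x₀ ∷ d) = begin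
  cnt (λ c → sameColors c (x₀ ∷ d)) (allVecs k (suc m))
    ≡⟨ cnt-concatMap _ (λ x → map (x ∷_) (allVecs k m)) (allFin k) ⟩
  sum (map (λ x → cnt (λ c → sameColors c (x₀ ∷ d)) (map (x ∷_) (allVecs k m))) (allFin k))
    ≡⟨ sum-cong first (allFin k) ⟩
  sum (map (λ x → ind (toℕ x₀ ≡ᵇ toℕ x)) (allFin k))
    ≡⟨ sum-ind (λ x → toℕ x₀ ≡ᵇ toℕ x) (allFin k) ⟩
  cnt (λ x → toℕ x₀ ≡ᵇ toℕ x) (allFin k)
    ≡⟨ cnt-equal x₀ ⟩
  1 ∎
  where
  open ≡-Reasoning
  first : ∀ x → cnt (λ c → sameColors c (x₀ ∷ d)) (map (x ∷_) (allVecs k m)) ≡ ind (toℕ x₀ ≡ᵇ toℕ x)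
  first x rewrite cnt-map (λ c → sameColors c (x₀ ∷ d)) (x ∷_) (allVecs k m)
    | cnt-guard (toℕ x ≡ᵇ toℕ x₀) (λ c → sameColors c d) (allVecs k m) | cnt-sameColors d | ≡ᵇ-sym (toℕ x) (toℕ x₀)
    with toℕ x₀ ≡ᵇ toℕ x
  ... | true = refl
  ... | false = refl

compat-map : {X : Set} (f : X → Letter3) (g : X → Letter) (l : List X) → compat (map f l) (map g l) ≡ all? (λ i → admits (f i) (g i)) l
compat-map f g [] = refl
compat-map f g (x ∷ l) = trans (compat-cons (f x) (map f l) (g x) (map g l)) (cong (admits (f x) (g x) ∧_) (compat-map f g l))

admits-asLetter3 : ∀ u u' → admits (asLetter3 u') u ≡ true → u ≡ u'
admits-asLetter3 a a _ = refl
admits-asLetter3 b b _ = refl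

admits-column : ∀ ci ci' u u' → ci ≡ ci' → (ci ≡ 0 → u ≡ u') → admits (if ci' ≡ᵇ 0 then asLetter3 u' else AB) u ≡ true
admits-column zero .zero a a refl same = refl
admits-column zero .zero b b refl same = refl
admits-column zero .zero a b refl same with () ← same refl
admits-column zero .zero b a refl same with () ← same refl
admits-column (suc c) .(suc c) u u' refl same = refl

∧-true : ∀ {x y} → (x ∧ y) ≡ true → (x ≡ true) × (y ≡ true)
∧-true {true} {true} _ = refl , refl

last-or-inject : ∀ {n} (i : Fin (suc n)) → (i ≡ fromℕ n) ⊎ Σ (Fin n) (λ j → i ≡ inject₁ j)
last-or-inject {zero} fzero = inj₁ refl
last-or-inject {suc n} fzero = inj₂ (fzero , refl)
last-or-inject {suc n} (fsuc i) with last-or-inject i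
... | inj₁ e = inj₁ (cong fsuc e)
... | inj₂ (j , e) = inj₂ (fsuc j , cong fsuc e)

module Fibres (r' n' : ℕ) (σ₀ : Vec (Fin (suc n')) (suc n')) (c₀ : Vec (Fin (suc r')) (suc n')) where
  r = suc r'
  n = suc n'
  π₀ : ColPerm r n
  π₀ = σ₀ , c₀

  color : Vec (Fin r) n → Fin n → ℕ
  color c i = toℕ (lookup c i)

  columnLetter : Fin n → Letter3
  columnLetter i = collapse (column r π₀ i)

  columnLetter-value : ∀ i → columnLetter i ≡ (if color c₀ i ≡ᵇ 0 then asLetter3 (excLetterAt σ₀ i) else AB)
  columnLetter-value i = trans (cong collapse (map-cong-local (All.tabulate (λ j∈ → entry-shape r' σ₀ c₀ i _ (∈-upTo⁻ j∈)))))
    (collapse-shape r' (color c₀ i) (excLetterAt σ₀ i) (toℕ<n (lookup c₀ i)))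

  compatible : Vec (Fin n) n → Bool
  compatible σ = compat (Ψ r π₀) (excWordS σ)

  compatible-columns : ∀ σ → compatible σ ≡ all? (λ i → admits (columnLetter i) (excLetterAt σ i)) (map inject₁ (allFin n'))
  compatible-columns σ = trans (cong (compat (Ψ r π₀)) (take-map n' (allFin n)))
    (trans (cong₂ (λ x y → compat (map columnLetter x) (map (excLetterAt σ) y)) (take-allFin n') (take-allFin n'))
    (compat-map columnLetter (excLetterAt σ) (map inject₁ (allFin n'))))

  same-word⇒ : ∀ σ c → excWord r (σ , c) ≡ excWord r π₀ → (compatible σ ∧ sameColors c c₀) ≡ true
  same-word⇒ σ c e = cong₂ _∧_
    (trans (compatible-columns σ) (all?-intro _ (map inject₁ (allFin n')) (λ {i} _ → admits-at i)))
    (sameColors-complete c c₀ (λ i → proj₁ (same-column i)))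
    where
    same-column : ∀ i → (color c i ≡ color c₀ i) × (color c i ≡ 0 → excLetterAt σ i ≡ excLetterAt σ₀ i)
    same-column i = column-determines r' (color c i) (color c₀ i) (excLetterAt σ i) (excLetterAt σ₀ i) (toℕ<n _) (toℕ<n _)
      (λ j j<r → trans (sym (entry-shape r' σ c i j j<r)) (trans (excWord-entries r' n' (σ , c) π₀ e i j j<r) (entry-shape r' σ₀ c₀ i j j<r)))
    admits-at : ∀ i → admits (columnLetter i) (excLetterAt σ i) ≡ true
    admits-at i rewrite columnLetter-value i = admits-column (color c i) (color c₀ i) _ _ (proj₁ (same-column i)) (proj₂ (same-column i))

  same-word⇐ : ∀ σ → compatible σ ≡ true → excWord r (σ , c₀) ≡ excWord r π₀
  same-word⇐ σ compat-σ = entries-excWord r' n' (σ , c₀) π₀ (λ i j j<r → trans (entry-shape r' σ c₀ i j j<r)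
      (trans (shape-cong r (color c₀ i) _ _ j (same-letter i)) (sym (entry-shape r' σ₀ c₀ i j j<r))))
    where
    same-letter : ∀ i → color c₀ i ≡ 0 → excLetterAt σ i ≡ excLetterAt σ₀ i
    same-letter i zero-color with last-or-inject i
    ... | inj₁ refl = trans (excLetterAt-last n' σ) (sym (excLetterAt-last n' σ₀))
    ... | inj₂ (j , refl) = admits-asLetter3 _ _
      (subst (λ x → admits x (excLetterAt σ (inject₁ j)) ≡ true)
        (trans (columnLetter-value (inject₁ j)) (cong (λ t → if t ≡ᵇ 0 then asLetter3 (excLetterAt σ₀ (inject₁ j)) else AB) zero-color))
        (all?-elim _ (map inject₁ (allFin n')) (trans (sym (compatible-columns σ)) compat-σ) (∈-map⁺ inject₁ (∈-allFin j))))

  same-word : ∀ σ c → (excWord r (σ , c) ==W excWord r π₀) ≡ (compatible σ ∧ sameColors c c₀)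
  same-word σ c with excWord r (σ , c) ==W excWord r π₀ in e₁ | compatible σ ∧ sameColors c c₀ in e₂
  ... | true | _ = sym (trans (sym e₂) (same-word⇒ σ c (==W-sound _ _ e₁)))
  ... | false | false = refl
  ... | false | true with ∧-true {compatible σ} {sameColors c c₀} e₂
  ...   | compat-σ , same-c with sameColors-sound c c₀ same-c
  ...     | refl = trans (sym e₁) (trans (cong (_==W excWord r π₀) (same-word⇐ σ compat-σ)) (==W-refl (excWord r π₀)))

  fibre : ∀ σ → cnt (λ c → excWord r (σ , c) ==W excWord r π₀) (allVecs r n) ≡ ind (compatible σ)
  fibre σ = trans (cnt-cong (same-word σ) (allVecs r n))
    (trans (cnt-guard (compatible σ) (λ c → sameColors c c₀) (allVecs r n)) (one-or-none (compatible σ)))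
    where
    one-or-none : ∀ t → (if t then cnt (λ c → sameColors c c₀) (allVecs r n) else 0) ≡ ind t
    one-or-none true = cnt-sameColors c₀
    one-or-none false = refl

  countG-countS : countG r n (excWord r π₀) ≡ countS n (Ψ r π₀)
  countG-countS = trans (cnt-concatMap (λ π → excWord r π ==W excWord r π₀) (λ σ → map (σ ,_) (allVecs r n)) perms)
    (trans (sum-cong (λ σ → trans (cnt-map (λ π → excWord r π ==W excWord r π₀) (σ ,_) (allVecs r n)) (fibre σ)) perms)
    (sum-ind compatible perms))
    where perms = filterᵇ isPerm (allVecs n n)

  length-Ψ : length (Ψ r π₀) ≡ n'
  length-Ψ = trans (length-map columnLetter (take n' (allFin n)))
    (trans (cong length (take-allFin n')) (trans (length-map inject₁ (allFin n')) (length-allFin n')))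

mainTheorem3 : (r n : ℕ) .{{_ : NonZero r}} .{{_ : NonZero n}} →
    (π₀ : ColPerm r n) → isColPerm π₀ ≡ true →
    (countG r n (excWord r π₀) ≡ countS n (Ψ r π₀))
      × (+ countS n (Ψ r π₀) ≡ formula (Ψ r π₀))
mainTheorem3 (suc r') (suc n') (σ₀ , c₀) _ =
  countG-countS , trans (countS-F n' (Ψ (suc r') π₀) length-Ψ) (sym (formula-F (Ψ (suc r') π₀)))
  where open Fibres r' n' σ₀ c₀
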